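{- Let $\alpha\in(0,1)$ be irrational with continued fraction denominators $(q_k)$, and let $f$ be the exhausting-point function of $v_0$ (see context). Let $n\ge2$ and let $k\ge0$ be such that $q_k\le n\le q_{k+1}-1$; write $n=q_k+j$ with $0\le j\le q_{k+1}-q_k-1$. Then $$f(q_k+j)=q_{k+1}+q_k-1+j.$$
   Context: Let $\alpha=[a_1,a_2,\dots]=\cfrac{1}{a_1+\cfrac{1}{a_2+\cdots}}$ ($a_i\in\mathbf{N}$) be the continued fraction expansion of the irrational $\alpha\in(0,1)$, and define $q_{ -1}=0$, $q_0=1$, $q_{k+1}=a_{k+1}q_k+q_{k-1}$ for $k\ge0$. Let $v_0\in\{0,1\}^{\mathbf{Z}}$, $v_0(n)=1_{[1-\alpha,1)}(n\alpha\bmod 1)$. For $n\ge1$ let $P_n$ be the set of words of length $n$ occurring as factors (blocks of consecutive letters) of $v_0$. Let $f(n)$ be the smallest $N\in\mathbf{N}$ such that every word of $P_n$ occurs as a factor of $(v_0(1),v_0(2),\dots,v_0(N))$. -}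

module Defs where

open import Data.Nat as ℕ using (ℕ; zero; suc)
open import Data.Integer as ℤ using (ℤ; +_)
open import Data.Bool using (Bool; true; false)
open import Data.Fin using (Fin; toℕ)
open import Data.Vec using (Vec; lookup)
open import Data.Product using (Σ; _×_; _,_; ∃; ∃-syntax; proj₁; proj₂)
open import Relation.Nullary using (¬_)

-- Partial quotients: A k = a_{k+1} (k ≥ 0), i.e. α = [A 0, A 1, A 2, …].
cf : (ℕ → ℕ) → ℕ → (ℕ × ℕ) × (ℕ × ℕ)
cf A zero = ((1 , 0) , (0 , 1))
cf A (suc k) with cf A k
... | ((p' , q') , (p , q)) = ((p , q) , (A k ℕ.* p ℕ.+ p' , A k ℕ.* q ℕ.+ q'))

p : (ℕ → ℕ) → ℕ → ℕ
p A k = proj₁ (proj₂ (cf A k))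

q : (ℕ → ℕ) → ℕ → ℕ
q A k = proj₂ (proj₂ (cf A k))

-- Real comparison  n·α < m  for integers n, m, where α = lim p_k/q_k:
-- eventually n·p_k < m·q_k.
MulLt : (ℕ → ℕ) → ℤ → ℤ → Set
MulLt A n m = ∃[ K ] (∀ k → K ℕ.≤ k → n ℤ.* (+ p A k) ℤ.< m ℤ.* (+ q A k))

-- v_0(n) = 1  iff  {nα} ∈ [1-α, 1)  iff  ∃ m ∈ ℤ with nα < m ≤ (n+1)α.
V1 : (ℕ → ℕ) → ℤ → Set
V1 A n = ∃[ m ] (MulLt A n m × ¬ MulLt A (n ℤ.+ ℤ.1ℤ) m)

V : (ℕ → ℕ) → ℤ → Bool → Set
V A n true  = V1 A n
V A n false = ¬ V1 A n

OccursAt : (ℕ → ℕ) → {L : ℕ} → Vec Bool L → ℤ → Set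
OccursAt A {L} w i = (t : Fin L) → V A (i ℤ.+ (+ toℕ t)) (lookup w t)

InP : (ℕ → ℕ) → {L : ℕ} → Vec Bool L → Set
InP A w = ∃[ i ] OccursAt A w i

OccursInPrefix : (ℕ → ℕ) → {L : ℕ} → Vec Bool L → ℕ → Set
OccursInPrefix A {L} w N =
  ∃[ i ] (1 ℕ.≤ i × i ℕ.+ L ℕ.≤ N ℕ.+ 1 × OccursAt A w (+ i))

Exhausts : (ℕ → ℕ) → ℕ → ℕ → Set
Exhausts A L N = (w : Vec Bool L) → InP A w → OccursInPrefix A w N

IsF : (ℕ → ℕ) → ℕ → ℕ → Set
IsF A L N = Exhausts A L N × (∀ M → Exhausts A L M → N ℕ.≤ M)

-- Fix a convergent P/Q = p_L/q_L with L large. For |x| < Q the comparison xα < m agrees with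
-- xP < mQ, so near the origin v_0(x) = ⌊(x+1)P/Q⌋ − ⌊xP/Q⌋, and a factor starting at x is governed by
-- the residue ρ(x) = xP mod Q through the carries in ⌊(x+s)P/Q⌋ = ⌊xP/Q⌋ + ⌊sP/Q⌋ + [ρ(x) + ρ(s) ≥ Q].
-- Lagrange's best approximation property, |dP − mQ| ≥ E := |q_k P − p_k Q| for 0 < |d| < q_{k+1},
-- controls these carries. Moving a window of length n < q_{k+1} so that it starts at its point of
-- least residue and then adding one of q_{k+1}, q_k, q_k + q_{k+1} (whose residues E′ < E, E, E − E′
-- are small, depending on the parity of k) shows that every factor occurs at a position in
-- [1, q_{k+1}]. Conversely, when n ≥ q_k the carry at s = q_k tells the factor at q_{k+1} apart from
-- the factors at all positions in [1, q_{k+1}), so it first occurs at q_{k+1}. Hence f(n) = q_{k+1} + n − 1.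

module Submission where

open import Data.Bool using (Bool; true; false)
open import Data.Empty using (⊥; ⊥-elim)
open import Data.Fin using (toℕ; fromℕ<)
open import Data.Fin.Properties using (toℕ<n; toℕ-fromℕ<)
open import Data.Integer hiding (suc)
open import Data.Integer using () renaming (suc to sucℤ)
open import Data.Integer.DivMod using (a≡a%ℕn+[a/ℕn]*n; n%ℕd<d; [n/ℕd]*d≤n; n<s[n/ℕd]*d)
open import Data.Integer.Properties
open import Data.Integer.Tactic.RingSolver using (solve-∀)
open import Data.Nat as ℕ using (ℕ; zero; suc)
import Data.Nat.Properties as ℕ
open import Data.Product using (Σ-syntax; _×_; _,_; proj₁; proj₂)
open import Data.Sum using (_⊎_; inj₁; inj₂)
open import Data.Vec using (Vec; lookup; tabulate)
open import Data.Vec.Properties using (lookup∘tabulate)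
open import Relation.Binary.PropositionalEquality
open import Relation.Nullary using (¬_; yes; no; does)

open import Defs

0≤+ : ∀ n → 0ℤ ≤ + n
0≤+ n = +≤+ ℕ.z≤n

1≤⇒0≤ : ∀ {i} → 1ℤ ≤ i → 0ℤ ≤ i
1≤⇒0≤ = ≤-trans (0≤+ 1)

*-nonNeg : ∀ {i j} → 0ℤ ≤ i → 0ℤ ≤ j → 0ℤ ≤ i * j
*-nonNeg {+ m} {+ n} _ _ = subst (0ℤ ≤_) (pos-* m n) (0≤+ _)

diff-nonNeg⇒≤ : ∀ {i j k} → j - i ≡ k → 0ℤ ≤ k → i ≤ j
diff-nonNeg⇒≤ eq h = 0≤i-j⇒j≤i (subst (0ℤ ≤_) (sym eq) h)

<⇒1≤diff : ∀ {i j} → i < j → 1ℤ ≤ j - i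
<⇒1≤diff {i} {j} i<j = diff-nonNeg⇒≤ (lemma i j) (i≤j⇒0≤j-i (i<j⇒suc[i]≤j i<j))
  where
  lemma : ∀ i j → (j - i) - 1ℤ ≡ j - (1ℤ + i)
  lemma = solve-∀

diff-pos⇒< : ∀ {i j k} → j - i ≡ k → 1ℤ ≤ k → i < j
diff-pos⇒< {i} {j} {k} eq h =
  suc[i]≤j⇒i<j (diff-nonNeg⇒≤ (trans (lemma i j) (cong (_- 1ℤ) eq)) (i≤j⇒0≤j-i h))
  where
  lemma : ∀ i j → j - (1ℤ + i) ≡ (j - i) - 1ℤ
  lemma = solve-∀

sign-cases : ∀ i → 1ℤ ≤ i ⊎ i ≡ 0ℤ ⊎ i ≤ -1ℤ
sign-cases (+ zero)  = inj₂ (inj₁ refl)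
sign-cases +[1+ n ]  = inj₁ (+≤+ (ℕ.s≤s ℕ.z≤n))
sign-cases -[1+ n ]  = inj₂ (inj₂ (-≤- ℕ.z≤n))

1≤∧≤-1⇒⊥ : ∀ {i} → 1ℤ ≤ i → i ≤ -1ℤ → ⊥
1≤∧≤-1⇒⊥ h₁ h₂ with ≤-trans h₁ h₂
... | ()

1≰0 : 1ℤ ≤ 0ℤ → ⊥
1≰0 (+≤+ ())

0≰-1 : 0ℤ ≤ -1ℤ → ⊥
0≰-1 ()

x+y≤ux+vy : ∀ {u v} x y → 1ℤ ≤ u → 1ℤ ≤ v → + x + + y ≤ u * + x + v * + y
x+y≤ux+vy {u} {v} x y 1≤u 1≤v = diff-nonNeg⇒≤ (lemma u v (+ x) (+ y))
  (+-mono-≤ (*-nonNeg (i≤j⇒0≤j-i 1≤u) (0≤+ x)) (*-nonNeg (i≤j⇒0≤j-i 1≤v) (0≤+ y)))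
  where
  lemma : ∀ u v x y → u * x + v * y - (x + y) ≡ (u - 1ℤ) * x + (v - 1ℤ) * y
  lemma = solve-∀

nonNeg-sum≡0 : ∀ {i j} → 0ℤ ≤ i → 0ℤ ≤ j → i + j ≡ 0ℤ → i ≡ 0ℤ × j ≡ 0ℤ
nonNeg-sum≡0 {i} {j} 0≤i 0≤j i+j≡0 =
  ≤-antisym (subst (i ≤_) i+j≡0 (i≤i+j i j {{nonNegative 0≤j}})) 0≤i ,
  ≤-antisym (subst (j ≤_) i+j≡0 (i≤j+i j i {{nonNegative 0≤i}})) 0≤j

i*j≡0⇒i≡0 : ∀ {i j} → 1ℤ ≤ j → i * j ≡ 0ℤ → i ≡ 0ℤ
i*j≡0⇒i≡0 {i} 1≤j i*j≡0 with i*j≡0⇒i≡0∨j≡0 i i*j≡0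
... | inj₁ i≡0 = i≡0
... | inj₂ j≡0 = ⊥-elim (1≰0 (subst (1ℤ ≤_) j≡0 1≤j))

c≤∣i∣ : ∀ {c} (i : ℤ) → + c ≤ i ⊎ i ≤ - + c → c ℕ.≤ ∣ i ∣
c≤∣i∣ (+ m)    (inj₁ (+≤+ c≤m)) = c≤m
c≤∣i∣ {c} -[1+ m ] (inj₂ h)    = drop‿+≤+ (subst (_≤ + suc m) (neg-involutive (+ c)) (neg-mono-≤ h))
c≤∣i∣ {zero}  _ _ = ℕ.z≤n
c≤∣i∣ {suc c} (+ m) (inj₂ ())

ε : ℕ → ℤ
ε zero    = 1ℤ
ε (suc k) = - ε k

ε-cases : ∀ k → ε k ≡ 1ℤ ⊎ ε k ≡ -1ℤ
ε-cases zero = inj₁ refl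
ε-cases (suc k) with ε-cases k
... | inj₁ e = inj₂ (cong -_ e)
... | inj₂ e = inj₁ (cong -_ e)

ε*ε≡1 : ∀ k → ε k * ε k ≡ 1ℤ
ε*ε≡1 k with ε-cases k
... | inj₁ e rewrite e = refl
... | inj₂ e rewrite e = refl

∣ε∣≡1 : ∀ k → ∣ ε k ∣ ≡ 1
∣ε∣≡1 k with ε-cases k
... | inj₁ e rewrite e = refl
... | inj₂ e rewrite e = refl

ε*[ε*i]≡i : ∀ k i → ε k * (ε k * i) ≡ i
ε*[ε*i]≡i k i = begin
  ε k * (ε k * i)  ≡⟨ *-assoc (ε k) (ε k) i ⟨
  ε k * ε k * i    ≡⟨ cong (_* i) (ε*ε≡1 k) ⟩
  1ℤ * i           ≡⟨ *-identityˡ i ⟩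
  i                ∎
  where open ≡-Reasoning

ε≡1⇒ε*i≡i : ∀ k i → ε k ≡ 1ℤ → ε k * i ≡ i
ε≡1⇒ε*i≡i k i ε≡1 = trans (cong (_* i) ε≡1) (*-identityˡ i)

ε≡-1⇒ε*i≡-i : ∀ k i → ε k ≡ -1ℤ → ε k * i ≡ - i
ε≡-1⇒ε*i≡-i k i ε≡-1 = trans (cong (_* i) ε≡-1) (-1*i≡-i i)

module _ (A : ℕ → ℕ) where

  pℤ qℤ aℤ : ℕ → ℤ
  pℤ k = + p A k
  qℤ k = + q A k
  aℤ k = + A k

  private
    pos-*-+ : ∀ a x y → + (a ℕ.* x ℕ.+ y) ≡ + a * + x + + y
    pos-*-+ a x y = trans (pos-+ (a ℕ.* x) y) (cong (_+ + y) (pos-* a x))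

  q-rec : ∀ k → qℤ (suc (suc k)) ≡ aℤ (suc k) * qℤ (suc k) + qℤ k
  q-rec k = pos-*-+ (A (suc k)) (q A (suc k)) (q A k)

  p-rec : ∀ k → pℤ (suc (suc k)) ≡ aℤ (suc k) * pℤ (suc k) + pℤ k
  p-rec k = pos-*-+ (A (suc k)) (p A (suc k)) (p A k)

  convergent-det : ∀ k → qℤ k * pℤ (suc k) - pℤ k * qℤ (suc k) ≡ ε k
  convergent-det zero rewrite ℕ.*-zeroʳ (A 0) = refl
  convergent-det (suc k) = begin
    qℤ (suc k) * pℤ (suc (suc k)) - pℤ (suc k) * qℤ (suc (suc k))
      ≡⟨ cong₂ (λ x y → qℤ (suc k) * x - pℤ (suc k) * y) (p-rec k) (q-rec k) ⟩
    qℤ (suc k) * (aℤ (suc k) * pℤ (suc k) + pℤ k) - pℤ (suc k) * (aℤ (suc k) * qℤ (suc k) + qℤ k)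
      ≡⟨ lemma (aℤ (suc k)) (qℤ (suc k)) (pℤ (suc k)) (qℤ k) (pℤ k) ⟩
    - (qℤ k * pℤ (suc k) - pℤ k * qℤ (suc k))
      ≡⟨ cong -_ (convergent-det k) ⟩
    - ε k ∎
    where
    open ≡-Reasoning
    lemma : ∀ a q₁ p₁ q₀ p₀ → q₁ * (a * p₁ + p₀) - p₁ * (a * q₁ + q₀) ≡ - (q₀ * p₁ - p₀ * q₁)
    lemma = solve-∀

  -- For j ≤ l, cross j l = |q_j p_l − p_j q_l| = q_l |q_j (p_l/q_l) − p_j|.
  cross : ℕ → ℕ → ℤ
  cross j l = ε j * (qℤ j * pℤ l - pℤ j * qℤ l)

  cross-self : ∀ j → cross j j ≡ 0ℤ
  cross-self j = lemma (ε j) (qℤ j) (pℤ j)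
    where
    lemma : ∀ e q p → e * (q * p - p * q) ≡ 0ℤ
    lemma = solve-∀

  cross-suc : ∀ j → cross j (suc j) ≡ 1ℤ
  cross-suc j = trans (cong (ε j *_) (convergent-det j)) (ε*ε≡1 j)

  cross-recʳ : ∀ j l → cross j (suc (suc l)) ≡ aℤ (suc l) * cross j (suc l) + cross j l
  cross-recʳ j l = trans (cong₂ (λ x y → ε j * (qℤ j * x - pℤ j * y)) (p-rec l) (q-rec l))
    (lemma (ε j) (aℤ (suc l)) (qℤ j) (pℤ j) (pℤ (suc l)) (qℤ (suc l)) (pℤ l) (qℤ l))
    where
    lemma : ∀ e a qj pj p₁ q₁ p₀ q₀ →
      e * (qj * (a * p₁ + p₀) - pj * (a * q₁ + q₀)) ≡ a * (e * (qj * p₁ - pj * q₁)) + e * (qj * p₀ - pj * q₀)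
    lemma = solve-∀

  cross-recˡ : ∀ j l → cross j l ≡ aℤ (suc j) * cross (suc j) l + cross (suc (suc j)) l
  cross-recˡ j l = trans
    (lemma (ε j) (aℤ (suc j)) (qℤ (suc j)) (pℤ (suc j)) (qℤ j) (pℤ j) (pℤ l) (qℤ l))
    (sym (cong₂ (λ x y → aℤ (suc j) * cross (suc j) l + ε (suc (suc j)) * (x * pℤ l - y * qℤ l)) (q-rec j) (p-rec j)))
    where
    lemma : ∀ e a q₁ p₁ q₀ p₀ P Q → e * (q₀ * P - p₀ * Q) ≡
      a * ((- e) * (q₁ * P - p₁ * Q)) + (- (- e)) * ((a * q₁ + q₀) * P - (a * p₁ + p₀) * Q)
    lemma = solve-∀

  cross-zero : ∀ l → cross 0 l ≡ pℤ l
  cross-zero l = lemma (pℤ l) (qℤ l)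
    where
    lemma : ∀ P Q → 1ℤ * (1ℤ * P - 0ℤ * Q) ≡ P
    lemma = solve-∀

≤-upward : ∀ (P : ℕ → Set) {L} → (∀ L′ → L ℕ.≤ L′ → P L′ → P (suc L′)) →
           P L → ∀ L′ → L ℕ.≤ L′ → P L′
≤-upward P step base L′ L≤L′ with ℕ.m≤n⇒m<n∨m≡n L≤L′
≤-upward P step base (suc L′) _ | inj₁ (ℕ.s≤s L≤L′) = step L′ L≤L′ (≤-upward P step base L′ L≤L′)
... | inj₂ refl = base

module _ (A : ℕ → ℕ) (A≥1 : ∀ i → 1 ℕ.≤ A i) where

  private
    q≤A*q : ∀ k → q A k ℕ.≤ A k ℕ.* q A k
    q≤A*q k = ℕ.m≤n*m (q A k) (A k) {{ℕ.>-nonZero (A≥1 k)}}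

  q≤q-suc : ∀ k → q A k ℕ.≤ q A (suc k)
  q≤q-suc zero    = subst (1 ℕ.≤_) (sym (ℕ.+-identityʳ (A 0 ℕ.* 1))) (q≤A*q 0)
  q≤q-suc (suc k) = ℕ.≤-trans (q≤A*q (suc k)) (ℕ.m≤m+n _ _)

  1≤q : ∀ k → 1 ℕ.≤ q A k
  1≤q zero    = ℕ.≤-refl
  1≤q (suc k) = ℕ.≤-trans (1≤q k) (q≤q-suc k)

  q-mono-≤ : ∀ {j k} → j ℕ.≤ k → q A j ℕ.≤ q A k
  q-mono-≤ {j} {k} = ≤-upward (λ k → q A j ℕ.≤ q A k) (λ k _ q≤ → ℕ.≤-trans q≤ (q≤q-suc k)) ℕ.≤-refl k

  k≤q-suc : ∀ k → k ℕ.≤ q A (suc k)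
  k≤q-suc zero    = ℕ.z≤n
  k≤q-suc (suc k) = ℕ.≤-trans (ℕ.+-mono-≤ (1≤q k) (k≤q-suc k))
    (ℕ.≤-trans (ℕ.≤-reflexive (ℕ.+-comm (q A k) (q A (suc k)))) (ℕ.+-monoˡ-≤ (q A k) (q≤A*q (suc k))))

  p≤q : ∀ k → p A k ℕ.≤ q A k
  p≤q k = proj₁ (both k)
    where
    both : ∀ k → p A k ℕ.≤ q A k × p A (suc k) ℕ.≤ q A (suc k)
    both zero = ℕ.z≤n , subst (ℕ._≤ q A 1) (sym (cong (ℕ._+ 1) (ℕ.*-zeroʳ (A 0)))) (1≤q 1)
    both (suc k) with both k
    ... | p≤q₀ , p≤q₁ = p≤q₁ , ℕ.+-mono-≤ (ℕ.*-monoʳ-≤ (A (suc k)) p≤q₁) p≤q₀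

  p<q : ∀ k → p A (suc (suc k)) ℕ.< q A (suc (suc k))
  p<q zero    = ℕ.+-mono-≤-< (ℕ.*-monoʳ-≤ (A 1) (p≤q 1)) ℕ.≤-refl
  p<q (suc k) = ℕ.+-mono-<-≤ (ℕ.*-monoʳ-< (A (suc (suc k))) {{ℕ.>-nonZero (A≥1 _)}} (p<q k)) (p≤q (suc k))

  private
    cross-pair : ∀ j l → j ℕ.≤ l → 0ℤ ≤ cross A j l × 1ℤ ≤ cross A j (suc l)
    cross-pair j = ≤-upward (λ l → 0ℤ ≤ cross A j l × 1ℤ ≤ cross A j (suc l)) step base
      where
      base : 0ℤ ≤ cross A j j × 1ℤ ≤ cross A j (suc j)
      base = ≤-reflexive (sym (cross-self A j)) , ≤-reflexive (sym (cross-suc A j))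
      lemma : ∀ a c₁ c₀ → a * c₁ + c₀ - 1ℤ ≡ (a - 1ℤ) * c₁ + (c₁ - 1ℤ) + c₀
      lemma = solve-∀
      step : ∀ l → j ℕ.≤ l → 0ℤ ≤ cross A j l × 1ℤ ≤ cross A j (suc l) →
             0ℤ ≤ cross A j (suc l) × 1ℤ ≤ cross A j (suc (suc l))
      step l _ (0≤c₀ , 1≤c₁) = 1≤⇒0≤ 1≤c₁ , diff-nonNeg⇒≤
        (trans (cong (_- 1ℤ) (cross-recʳ A j l)) (lemma (aℤ A (suc l)) (cross A j (suc l)) (cross A j l)))
        (+-mono-≤ (+-mono-≤ (*-nonNeg (i≤j⇒0≤j-i (+≤+ (A≥1 _))) (1≤⇒0≤ 1≤c₁)) (i≤j⇒0≤j-i 1≤c₁)) 0≤c₀)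

  cross-nonNeg : ∀ j l → j ℕ.≤ l → 0ℤ ≤ cross A j l
  cross-nonNeg j l j≤l = proj₁ (cross-pair j l j≤l)

  cross-pos : ∀ j l → j ℕ.< l → 1ℤ ≤ cross A j l
  cross-pos j (suc l) (ℕ.s≤s j≤l) = proj₂ (cross-pair j l j≤l)

  private
    cross-diff : ∀ j l →
      cross A j l - cross A (suc j) l ≡ (aℤ A (suc j) - 1ℤ) * cross A (suc j) l + cross A (suc (suc j)) l
    cross-diff j l = trans (cong (_- cross A (suc j) l) (cross-recˡ A j l))
      (lemma (aℤ A (suc j)) (cross A (suc j) l) (cross A (suc (suc j)) l))
      where
      lemma : ∀ a c₁ c₂ → a * c₁ + c₂ - c₁ ≡ (a - 1ℤ) * c₁ + c₂
      lemma = solve-∀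

    0≤[a-1]*cross : ∀ j l → suc j ℕ.≤ l → 0ℤ ≤ (aℤ A (suc j) - 1ℤ) * cross A (suc j) l
    0≤[a-1]*cross j l j+1≤l = *-nonNeg (i≤j⇒0≤j-i (+≤+ (A≥1 _))) (cross-nonNeg (suc j) l j+1≤l)

  cross-anti : ∀ j l → suc (suc j) ℕ.≤ l → cross A (suc j) l ≤ cross A j l
  cross-anti j l j+2≤l = diff-nonNeg⇒≤ (cross-diff j l)
    (+-mono-≤ (0≤[a-1]*cross j l (ℕ.≤-trans (ℕ.n≤1+n _) j+2≤l)) (cross-nonNeg (suc (suc j)) l j+2≤l))

  cross-strictAnti : ∀ j l → suc (suc j) ℕ.< l → cross A (suc j) l < cross A j l
  cross-strictAnti j l j+2<l = diff-pos⇒< (cross-diff j l)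
    (≤-trans (cross-pos (suc (suc j)) l j+2<l)
      (i≤j+i _ _ {{nonNegative (0≤[a-1]*cross j l (ℕ.≤-trans (ℕ.n≤1+n _) (ℕ.<⇒≤ j+2<l)))}}))

  cross≤p : ∀ j l → j ℕ.< l → cross A j l ≤ pℤ A l
  cross≤p zero    l _     = ≤-reflexive (cross-zero A l)
  cross≤p (suc j) l j+1<l = ≤-trans (cross-anti j l j+1<l) (cross≤p j l (ℕ.<-trans (ℕ.n<1+n j) j+1<l))

m*n<n⇒m≡0 : ∀ a b → a ℕ.* b ℕ.< b → a ≡ 0
m*n<n⇒m≡0 zero    b _   = refl
m*n<n⇒m≡0 (suc a) b a*b<b = ⊥-elim (ℕ.<⇒≱ a*b<b (ℕ.m≤m+n b (a ℕ.* b)))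

-- gap l = q_l (m − n p_l/q_l). Once |n| < q_l its sign never changes again, so the comparison
-- nα < m of MulLt is decided by the single convergent p_l/q_l.
module _ (A : ℕ → ℕ) (A≥1 : ∀ i → 1 ℕ.≤ A i) (n m : ℤ) where

  gap : ℕ → ℤ
  gap k = m * qℤ A k - n * pℤ A k

  gap-det : ∀ k → gap k * qℤ A (suc k) - gap (suc k) * qℤ A k ≡ n * ε k
  gap-det k = trans (lemma m n (qℤ A k) (pℤ A k) (qℤ A (suc k)) (pℤ A (suc k))) (cong (n *_) (convergent-det A k))
    where
    lemma : ∀ m n q₀ p₀ q₁ p₁ → (m * q₀ - n * p₀) * q₁ - (m * q₁ - n * p₁) * q₀ ≡ n * (q₀ * p₁ - p₀ * q₁)
    lemma = solve-∀

  ∣gap-det∣ : ∀ k → ∣ gap k * qℤ A (suc k) - gap (suc k) * qℤ A k ∣ ≡ ∣ n ∣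
  ∣gap-det∣ k = begin
    ∣ gap k * qℤ A (suc k) - gap (suc k) * qℤ A k ∣  ≡⟨ cong ∣_∣ (gap-det k) ⟩
    ∣ n * ε k ∣                                     ≡⟨ abs-* n (ε k) ⟩
    ∣ n ∣ ℕ.* ∣ ε k ∣                               ≡⟨ cong (∣ n ∣ ℕ.*_) (∣ε∣≡1 k) ⟩
    ∣ n ∣ ℕ.* 1                                     ≡⟨ ℕ.*-identityʳ ∣ n ∣ ⟩
    ∣ n ∣                                           ∎
    where open ≡-Reasoning

  gap-no-sign-change : ∀ k → ∣ n ∣ ℕ.< q A k ℕ.+ q A (suc k) →
    (1ℤ ≤ gap k × gap (suc k) ≤ -1ℤ) ⊎ (gap k ≤ -1ℤ × 1ℤ ≤ gap (suc k)) → ⊥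
  gap-no-sign-change k bound signs =
    ℕ.<⇒≱ bound (subst (q A k ℕ.+ q A (suc k) ℕ.≤_) (∣gap-det∣ k) (c≤∣i∣ _ (bounds signs)))
    where
    X : ℤ
    X = gap k * qℤ A (suc k) - gap (suc k) * qℤ A k
    lemma₁ : ∀ g g′ x y → (- g′) * x + g * y ≡ g * y - g′ * x
    lemma₁ = solve-∀
    lemma₂ : ∀ g g′ x y → g′ * x + (- g) * y ≡ - (g * y - g′ * x)
    lemma₂ = solve-∀
    bounds : (1ℤ ≤ gap k × gap (suc k) ≤ -1ℤ) ⊎ (gap k ≤ -1ℤ × 1ℤ ≤ gap (suc k)) →
             + (q A k ℕ.+ q A (suc k)) ≤ X ⊎ X ≤ - + (q A k ℕ.+ q A (suc k))
    bounds (inj₁ (h , h′)) = inj₁ (subst (_ ≤_) (lemma₁ (gap k) (gap (suc k)) (qℤ A k) (qℤ A (suc k)))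
      (x+y≤ux+vy (q A k) (q A (suc k)) (neg-mono-≤ h′) h))
    bounds (inj₂ (h , h′)) = inj₂ (subst (_≤ _) (neg-involutive X) (neg-mono-≤
      (subst (_ ≤_) (lemma₂ (gap k) (gap (suc k)) (qℤ A k) (qℤ A (suc k)))
        (x+y≤ux+vy (q A k) (q A (suc k)) h′ (neg-mono-≤ h)))))

  gap≡0⇒n≡0 : ∀ L → ∣ n ∣ ℕ.< q A L → gap L ≡ 0ℤ → n ≡ 0ℤ
  gap≡0⇒n≡0 L bound gapL≡0 = ∣i∣≡0⇒i≡0 (trans (sym ∣n∣≡) (cong (ℕ._* q A L) ∣gap∣≡0))
    where
    lemma : ∀ g x y → 0ℤ * x - g * y ≡ - (g * y)
    lemma = solve-∀
    ∣n∣≡ : ∣ gap (suc L) ∣ ℕ.* q A L ≡ ∣ n ∣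
    ∣n∣≡ = begin
      ∣ gap (suc L) ∣ ℕ.* q A L                          ≡⟨ abs-* (gap (suc L)) (qℤ A L) ⟨
      ∣ gap (suc L) * qℤ A L ∣                           ≡⟨ ∣-i∣≡∣i∣ (gap (suc L) * qℤ A L) ⟨
      ∣ - (gap (suc L) * qℤ A L) ∣                       ≡⟨ cong ∣_∣ (lemma (gap (suc L)) (qℤ A (suc L)) (qℤ A L)) ⟨
      ∣ 0ℤ * qℤ A (suc L) - gap (suc L) * qℤ A L ∣       ≡⟨ cong (λ g → ∣ g * qℤ A (suc L) - gap (suc L) * qℤ A L ∣) gapL≡0 ⟨
      ∣ gap L * qℤ A (suc L) - gap (suc L) * qℤ A L ∣    ≡⟨ ∣gap-det∣ L ⟩
      ∣ n ∣                                              ∎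
      where open ≡-Reasoning
    ∣gap∣≡0 : ∣ gap (suc L) ∣ ≡ 0
    ∣gap∣≡0 = m*n<n⇒m≡0 _ _ (subst (ℕ._< q A L) (sym ∣n∣≡) bound)

  gap-vanishes : ∀ L → ∣ n ∣ ℕ.< q A L → gap L ≡ 0ℤ → ∀ L′ → gap L′ ≡ 0ℤ
  gap-vanishes L bound gapL≡0 with gap≡0⇒n≡0 L bound gapL≡0
  ... | refl = λ L′ → trans (cong (λ m → m * qℤ A L′ - 0ℤ * pℤ A L′) m≡0) (lemma (qℤ A L′) (pℤ A L′))
    where
    lemma : ∀ x y → 0ℤ * x - 0ℤ * y ≡ 0ℤ
    lemma = solve-∀
    drop0 : ∀ m x y → m * x - 0ℤ * y ≡ m * x
    drop0 = solve-∀
    m≡0 : m ≡ 0ℤ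
    m≡0 = *-cancelʳ-≡ m 0ℤ (qℤ A L) {{ℕ.>-nonZero (1≤q A A≥1 L)}}
      (trans (sym (drop0 m (qℤ A L) (pℤ A L))) (trans gapL≡0 (sym (*-zeroˡ (qℤ A L)))))

  private
    bound-upward : ∀ {L L′} → L ℕ.≤ L′ → ∣ n ∣ ℕ.< q A L → ∣ n ∣ ℕ.< q A L′
    bound-upward L≤L′ bound = ℕ.<-≤-trans bound (q-mono-≤ A A≥1 L≤L′)

    bound-sum : ∀ L → ∣ n ∣ ℕ.< q A L → ∣ n ∣ ℕ.< q A L ℕ.+ q A (suc L)
    bound-sum L bound = ℕ.<-≤-trans bound (ℕ.m≤m+n _ _)

  gap-pos-step : ∀ L → ∣ n ∣ ℕ.< q A L → 1ℤ ≤ gap L → 1ℤ ≤ gap (suc L)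
  gap-pos-step L bound 1≤gap with sign-cases (gap (suc L))
  ... | inj₁ 1≤gap′ = 1≤gap′
  ... | inj₂ (inj₁ gap′≡0) =
    ⊥-elim (1≰0 (subst (1ℤ ≤_) (gap-vanishes (suc L) (bound-upward (ℕ.n≤1+n L) bound) gap′≡0 L) 1≤gap))
  ... | inj₂ (inj₂ gap′≤-1) = ⊥-elim (gap-no-sign-change L (bound-sum L bound) (inj₁ (1≤gap , gap′≤-1)))

  gap-neg-step : ∀ L → ∣ n ∣ ℕ.< q A L → gap L ≤ -1ℤ → gap (suc L) ≤ -1ℤ
  gap-neg-step L bound gap≤-1 with sign-cases (gap (suc L))
  ... | inj₂ (inj₂ gap′≤-1) = gap′≤-1
  ... | inj₂ (inj₁ gap′≡0) =
    ⊥-elim (0≰-1 (subst (_≤ -1ℤ) (gap-vanishes (suc L) (bound-upward (ℕ.n≤1+n L) bound) gap′≡0 L) gap≤-1))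
  ... | inj₁ 1≤gap′ = ⊥-elim (gap-no-sign-change L (bound-sum L bound) (inj₂ (gap≤-1 , 1≤gap′)))

  gap-pos-from : ∀ L → ∣ n ∣ ℕ.< q A L → 1ℤ ≤ gap L → ∀ L′ → L ℕ.≤ L′ → 1ℤ ≤ gap L′
  gap-pos-from L bound = ≤-upward (λ L′ → 1ℤ ≤ gap L′) (λ L′ L≤L′ → gap-pos-step L′ (bound-upward L≤L′ bound))

  gap-neg-from : ∀ L → ∣ n ∣ ℕ.< q A L → gap L ≤ -1ℤ → ∀ L′ → L ℕ.≤ L′ → gap L′ ≤ -1ℤ
  gap-neg-from L bound = ≤-upward (λ L′ → gap L′ ≤ -1ℤ) (λ L′ L≤L′ → gap-neg-step L′ (bound-upward L≤L′ bound))

  convergent⇒MulLt : ∀ L → ∣ n ∣ ℕ.< q A L → n * pℤ A L < m * qℤ A L → MulLt A n m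
  convergent⇒MulLt L bound lt = L , λ L′ L≤L′ → diff-pos⇒< refl (gap-pos-from L bound (<⇒1≤diff lt) L′ L≤L′)

  MulLt⇒convergent : ∀ L → ∣ n ∣ ℕ.< q A L → MulLt A n m → n * pℤ A L < m * qℤ A L
  MulLt⇒convergent L bound (K , lt) with sign-cases (gap L)
  ... | inj₁ 1≤gap = diff-pos⇒< refl 1≤gap
  ... | inj₂ (inj₁ gap≡0) = ⊥-elim (1≰0 (subst (1ℤ ≤_) (gap-vanishes L bound gap≡0 (K ℕ.+ L)) 1≤gap[K+L]))
    where
    1≤gap[K+L] : 1ℤ ≤ gap (K ℕ.+ L)
    1≤gap[K+L] = <⇒1≤diff (lt (K ℕ.+ L) (ℕ.m≤m+n K L))
  ... | inj₂ (inj₂ gap≤-1) = ⊥-elim (1≤∧≤-1⇒⊥ 1≤gap[K+L] (gap-neg-from L bound gap≤-1 (K ℕ.+ L) (ℕ.m≤n+m L K)))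
    where
    1≤gap[K+L] : 1ℤ ≤ gap (K ℕ.+ L)
    1≤gap[K+L] = <⇒1≤diff (lt (K ℕ.+ L) (ℕ.m≤m+n K L))

<suc⇒≤ : ∀ {i j} → i < sucℤ j → i ≤ j
<suc⇒≤ {i} {j} i<suc = subst (i ≤_) (pred-suc j) (i<j⇒i≤pred[j] i<suc)

module Floor (A : ℕ → ℕ) (A≥1 : ∀ i → 1 ℕ.≤ A i) (L : ℕ) where

  Q : ℕ
  Q = q A L

  Qℤ Pℤ : ℤ
  Qℤ = qℤ A L
  Pℤ = pℤ A L

  instance
    Q-nonZero : ℕ.NonZero Q
    Q-nonZero = ℕ.>-nonZero (1≤q A A≥1 L)

  -- Opaque, as unfolding the division makes the conversion checker expand q A L through the
  -- continuant recursion.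
  opaque
    φ ρ : ℤ → ℤ
    φ x = (x * Pℤ) /ℕ Q
    ρ x = + ((x * Pℤ) %ℕ Q)

    φ-ρ : ∀ x → x * Pℤ ≡ φ x * Qℤ + ρ x
    φ-ρ x = trans (a≡a%ℕn+[a/ℕn]*n (x * Pℤ) Q) (+-comm (ρ x) (φ x * Qℤ))

    0≤ρ : ∀ x → 0ℤ ≤ ρ x
    0≤ρ x = 0≤+ _

    ρ<Q : ∀ x → ρ x < Qℤ
    ρ<Q x = +<+ (n%ℕd<d (x * Pℤ) Q)

    φQ≤xP : ∀ x → φ x * Qℤ ≤ x * Pℤ
    φQ≤xP x = [n/ℕd]*d≤n (x * Pℤ) Q

    xP<[1+φ]Q : ∀ x → x * Pℤ < sucℤ (φ x) * Qℤ
    xP<[1+φ]Q x = n<s[n/ℕd]*d (x * Pℤ) Q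

  φ-unique : ∀ x y {w} → x * Pℤ ≡ y * Qℤ + w → 0ℤ ≤ w → w < Qℤ → φ x ≡ y
  φ-unique x y {w} eq 0≤w w<Q = ≤-antisym (<suc⇒≤ φ<suc[y]) (<suc⇒≤ y<suc[φ])
    where
    lemma : ∀ y w Q → (1ℤ + y) * Q - (y * Q + w) ≡ Q - w
    lemma = solve-∀
    yQ≤xP : y * Qℤ ≤ x * Pℤ
    yQ≤xP = subst (y * Qℤ ≤_) (sym eq) (i≤i+j (y * Qℤ) w {{nonNegative 0≤w}})
    xP<suc[y]Q : x * Pℤ < sucℤ y * Qℤ
    xP<suc[y]Q = diff-pos⇒< (trans (cong (λ z → sucℤ y * Qℤ - z) eq) (lemma y w Qℤ)) (<⇒1≤diff w<Q)
    φ<suc[y] : φ x < sucℤ y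
    φ<suc[y] = *-cancelʳ-<-nonNeg Qℤ (≤-<-trans (φQ≤xP x) xP<suc[y]Q)
    y<suc[φ] : y < sucℤ (φ x)
    y<suc[φ] = *-cancelʳ-<-nonNeg Qℤ (≤-<-trans yQ≤xP (xP<[1+φ]Q x))

  ρ-unique : ∀ x y {w} → x * Pℤ ≡ y * Qℤ + w → 0ℤ ≤ w → w < Qℤ → ρ x ≡ w
  ρ-unique x y {w} eq 0≤w w<Q = begin
    ρ x                        ≡⟨ lemma (ρ x) (φ x * Qℤ) ⟩
    φ x * Qℤ + ρ x - φ x * Qℤ  ≡⟨ cong (_- φ x * Qℤ) (trans (sym (φ-ρ x)) eq) ⟩
    y * Qℤ + w - φ x * Qℤ      ≡⟨ cong (λ z → y * Qℤ + w - z * Qℤ) (φ-unique x y eq 0≤w w<Q) ⟩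
    y * Qℤ + w - y * Qℤ        ≡⟨ lemma w (y * Qℤ) ⟨
    w                          ∎
    where
    open ≡-Reasoning
    lemma : ∀ r a → r ≡ a + r - a
    lemma = solve-∀

  φρ-+ : ∀ x d → (x + d) * Pℤ ≡ (φ x + φ d) * Qℤ + (ρ x + ρ d)
  φρ-+ x d = begin
    (x + d) * Pℤ                                ≡⟨ *-distribʳ-+ Pℤ x d ⟩
    x * Pℤ + d * Pℤ                             ≡⟨ cong₂ _+_ (φ-ρ x) (φ-ρ d) ⟩
    (φ x * Qℤ + ρ x) + (φ d * Qℤ + ρ d)         ≡⟨ lemma (φ x) (φ d) Qℤ (ρ x) (ρ d) ⟩
    (φ x + φ d) * Qℤ + (ρ x + ρ d)              ∎
    where
    open ≡-Reasoning
    lemma : ∀ a b Q r s → (a * Q + r) + (b * Q + s) ≡ (a + b) * Q + (r + s)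
    lemma = solve-∀

  φ-+-noCarry : ∀ x d → ρ x + ρ d < Qℤ → φ (x + d) ≡ φ x + φ d
  φ-+-noCarry x d noCarry = φ-unique (x + d) (φ x + φ d) (φρ-+ x d) (+-mono-≤ (0≤ρ x) (0≤ρ d)) noCarry

  private
    carried : ∀ x d → (x + d) * Pℤ ≡ sucℤ (φ x + φ d) * Qℤ + (ρ x + ρ d - Qℤ)
    carried x d = trans (φρ-+ x d) (lemma (φ x + φ d) Qℤ (ρ x + ρ d))
      where
      lemma : ∀ a Q r → a * Q + r ≡ (1ℤ + a) * Q + (r - Q)
      lemma = solve-∀

    carried<Q : ∀ x d → ρ x + ρ d - Qℤ < Qℤ
    carried<Q x d = diff-pos⇒< (lemma Qℤ (ρ x) (ρ d))
      (+-mono-≤ (<⇒1≤diff (ρ<Q x)) (i≤j⇒0≤j-i (<⇒≤ (ρ<Q d))))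
      where
      lemma : ∀ Q r s → Q - (r + s - Q) ≡ (Q - r) + (Q - s)
      lemma = solve-∀

  φ-+-carry : ∀ x d → Qℤ ≤ ρ x + ρ d → φ (x + d) ≡ sucℤ (φ x + φ d)
  φ-+-carry x d carry = φ-unique (x + d) (sucℤ (φ x + φ d)) (carried x d) (i≤j⇒0≤j-i carry) (carried<Q x d)

  ρ-+-carry : ∀ x d → Qℤ ≤ ρ x + ρ d → ρ (x + d) ≡ ρ x + ρ d - Qℤ
  ρ-+-carry x d carry = ρ-unique (x + d) (sucℤ (φ x + φ d)) (carried x d) (i≤j⇒0≤j-i carry) (carried<Q x d)

  V1⇒φ< : ∀ t → ∣ t ∣ ℕ.< Q → ∣ t + 1ℤ ∣ ℕ.< Q → V1 A t → φ t < φ (t + 1ℤ)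
  V1⇒φ< t bound bound′ (m , tα<m , ¬[t+1]α<m) = <-≤-trans φ<m (<suc⇒≤ m<suc[φ])
    where
    tP<mQ : t * Pℤ < m * Qℤ
    tP<mQ = MulLt⇒convergent A A≥1 t m L bound tα<m
    mQ≤[t+1]P : m * Qℤ ≤ (t + 1ℤ) * Pℤ
    mQ≤[t+1]P = ≮⇒≥ (λ lt → ¬[t+1]α<m (convergent⇒MulLt A A≥1 (t + 1ℤ) m L bound′ lt))
    φ<m : φ t < m
    φ<m = *-cancelʳ-<-nonNeg Qℤ (≤-<-trans (φQ≤xP t) tP<mQ)
    m<suc[φ] : m < sucℤ (φ (t + 1ℤ))
    m<suc[φ] = *-cancelʳ-<-nonNeg Qℤ (≤-<-trans mQ≤[t+1]P (xP<[1+φ]Q (t + 1ℤ)))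

  φ<⇒V1 : ∀ t → ∣ t ∣ ℕ.< Q → ∣ t + 1ℤ ∣ ℕ.< Q → φ t < φ (t + 1ℤ) → V1 A t
  φ<⇒V1 t bound bound′ φ< = φ (t + 1ℤ) , convergent⇒MulLt A A≥1 t (φ (t + 1ℤ)) L bound tP<φQ , ¬[t+1]α<φ
    where
    tP<φQ : t * Pℤ < φ (t + 1ℤ) * Qℤ
    tP<φQ = <-≤-trans (xP<[1+φ]Q t) (*-monoʳ-≤-nonNeg Qℤ (i<j⇒suc[i]≤j φ<))
    ¬[t+1]α<φ : ¬ MulLt A (t + 1ℤ) (φ (t + 1ℤ))
    ¬[t+1]α<φ lt = <⇒≱ (MulLt⇒convergent A A≥1 (t + 1ℤ) (φ (t + 1ℤ)) L bound′ lt) (φQ≤xP (t + 1ℤ))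

  Δφ : ℤ → ℤ
  Δφ x = φ (x + 1ℤ) - φ x

  φ-1 : Pℤ < Qℤ → φ 1ℤ ≡ 0ℤ
  φ-1 P<Q = φ-unique 1ℤ 0ℤ (lemma Pℤ Qℤ) (0≤+ _) P<Q
    where
    lemma : ∀ P Q → 1ℤ * P ≡ 0ℤ * Q + P
    lemma = solve-∀

  Δφ∈01 : Pℤ < Qℤ → ∀ x → Δφ x ≡ 0ℤ ⊎ Δφ x ≡ 1ℤ
  Δφ∈01 P<Q x with ρ x + ρ 1ℤ <? Qℤ
  ... | yes noCarry = inj₁ (begin
    φ (x + 1ℤ) - φ x         ≡⟨ cong (_- φ x) (φ-+-noCarry x 1ℤ noCarry) ⟩
    φ x + φ 1ℤ - φ x         ≡⟨ cong (λ z → φ x + z - φ x) (φ-1 P<Q) ⟩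
    φ x + 0ℤ - φ x           ≡⟨ lemma (φ x) ⟩
    0ℤ                       ∎)
    where
    open ≡-Reasoning
    lemma : ∀ a → a + 0ℤ - a ≡ 0ℤ
    lemma = solve-∀
  ... | no carry = inj₂ (begin
    φ (x + 1ℤ) - φ x         ≡⟨ cong (_- φ x) (φ-+-carry x 1ℤ (≮⇒≥ carry)) ⟩
    sucℤ (φ x + φ 1ℤ) - φ x  ≡⟨ cong (λ z → sucℤ (φ x + z) - φ x) (φ-1 P<Q) ⟩
    sucℤ (φ x + 0ℤ) - φ x    ≡⟨ lemma (φ x) ⟩
    1ℤ                       ∎)
    where
    open ≡-Reasoning
    lemma : ∀ a → (1ℤ + (a + 0ℤ)) - a ≡ 1ℤ
    lemma = solve-∀

  ⟦_⟧ : Bool → ℤ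
  ⟦ true  ⟧ = 1ℤ
  ⟦ false ⟧ = 0ℤ

  V⇒Δφ : Pℤ < Qℤ → ∀ x b → ∣ x ∣ ℕ.< Q × ∣ x + 1ℤ ∣ ℕ.< Q → V A x b → Δφ x ≡ ⟦ b ⟧
  V⇒Δφ P<Q x true  (bound , bound′) v with Δφ∈01 P<Q x
  ... | inj₁ Δ≡0 = ⊥-elim (<-irrefl (sym (i-j≡0⇒i≡j _ _ Δ≡0)) (V1⇒φ< x bound bound′ v))
  ... | inj₂ Δ≡1 = Δ≡1
  V⇒Δφ P<Q x false (bound , bound′) ¬v with Δφ∈01 P<Q x
  ... | inj₁ Δ≡0 = Δ≡0
  ... | inj₂ Δ≡1 = ⊥-elim (¬v (φ<⇒V1 x bound bound′ (diff-pos⇒< Δ≡1 ≤-refl)))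

  Δφ⇒V : ∀ x b → ∣ x ∣ ℕ.< Q × ∣ x + 1ℤ ∣ ℕ.< Q → Δφ x ≡ ⟦ b ⟧ → V A x b
  Δφ⇒V x true  (bound , bound′) Δ≡1 = φ<⇒V1 x bound bound′ (diff-pos⇒< Δ≡1 ≤-refl)
  Δφ⇒V x false (bound , bound′) Δ≡0 v = 1≰0 (subst (1ℤ ≤_) Δ≡0 (<⇒1≤diff (V1⇒φ< x bound bound′ v)))

module BestApproximation (A : ℕ → ℕ) (A≥1 : ∀ i → 1 ℕ.≤ A i) (K k : ℕ) (k<K : k ℕ.< K) where

  open Floor A A≥1 (suc (suc K)) public

  L : ℕ
  L = suc (suc K)

  k<L : k ℕ.< L
  k<L = ℕ.m<n⇒m<1+n (ℕ.m<n⇒m<1+n k<K)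

  E E′ : ℤ
  E  = cross A k L
  E′ = cross A (suc k) L

  1≤E : 1ℤ ≤ E
  1≤E = cross-pos A A≥1 k L k<L

  1≤E′ : 1ℤ ≤ E′
  1≤E′ = cross-pos A A≥1 (suc k) L (ℕ.m<n⇒m<1+n (ℕ.s≤s k<K))

  E′<E : E′ < E
  E′<E = cross-strictAnti A A≥1 k L (ℕ.s≤s (ℕ.s≤s k<K))

  P<Q : Pℤ < Qℤ
  P<Q = +<+ (p<q A A≥1 K)

  E<Q : E < Qℤ
  E<Q = ≤-<-trans (cross≤p A A≥1 k L k<L) P<Q

  q*P-p*Q : ∀ j → qℤ A j * Pℤ - pℤ A j * Qℤ ≡ ε j * cross A j L
  q*P-p*Q j = sym (ε*[ε*i]≡i j _)

  private
    ≤-E⇒neg : ∀ {x} → 0ℤ ≤ x → x ≤ - E → ⊥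
    ≤-E⇒neg 0≤x x≤-E = 0≰-1 (≤-trans 0≤x (≤-trans x≤-E (neg-mono-≤ 1≤E)))

  -- The convergent matrix is unimodular, so d = u q_k + v q_{k+1} and ε_k (dP − mQ) = uE − vE′;
  -- for 0 < |d| < q_{k+1} the coefficients u ≠ 0 and v cannot have the same sign.
  module Decomposition (d m : ℤ) where

    u v : ℤ
    u = ε k * (d * pℤ A (suc k) - m * qℤ A (suc k))
    v = ε k * (m * qℤ A k - d * pℤ A k)

    d≡uq+vq : d ≡ u * qℤ A k + v * qℤ A (suc k)
    d≡uq+vq = sym (begin
      u * qℤ A k + v * qℤ A (suc k)
        ≡⟨ lemma (ε k) d m (qℤ A k) (pℤ A k) (qℤ A (suc k)) (pℤ A (suc k)) ⟩
      ε k * ((qℤ A k * pℤ A (suc k) - pℤ A k * qℤ A (suc k)) * d)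
        ≡⟨ cong (λ z → ε k * (z * d)) (convergent-det A k) ⟩
      ε k * (ε k * d)
        ≡⟨ ε*[ε*i]≡i k d ⟩
      d ∎)
      where
      open ≡-Reasoning
      lemma : ∀ e d m q p q₁ p₁ → e * (d * p₁ - m * q₁) * q + e * (m * q - d * p) * q₁ ≡ e * ((q * p₁ - p * q₁) * d)
      lemma = solve-∀

    X≡u[qP-pQ]+v[qP-pQ] :
      u * (qℤ A k * Pℤ - pℤ A k * Qℤ) + v * (qℤ A (suc k) * Pℤ - pℤ A (suc k) * Qℤ) ≡ d * Pℤ - m * Qℤ
    X≡u[qP-pQ]+v[qP-pQ] = begin
      u * (qℤ A k * Pℤ - pℤ A k * Qℤ) + v * (qℤ A (suc k) * Pℤ - pℤ A (suc k) * Qℤ)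
        ≡⟨ lemma (ε k) d m (qℤ A k) (pℤ A k) (qℤ A (suc k)) (pℤ A (suc k)) Pℤ Qℤ ⟩
      ε k * ((qℤ A k * pℤ A (suc k) - pℤ A k * qℤ A (suc k)) * (d * Pℤ - m * Qℤ))
        ≡⟨ cong (λ z → ε k * (z * (d * Pℤ - m * Qℤ))) (convergent-det A k) ⟩
      ε k * (ε k * (d * Pℤ - m * Qℤ))
        ≡⟨ ε*[ε*i]≡i k _ ⟩
      d * Pℤ - m * Qℤ ∎
      where
      open ≡-Reasoning
      lemma : ∀ e d m q p q₁ p₁ P Q →
        e * (d * p₁ - m * q₁) * (q * P - p * Q) + e * (m * q - d * p) * (q₁ * P - p₁ * Q) ≡
        e * ((q * p₁ - p * q₁) * (d * P - m * Q))
      lemma = solve-∀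

    εX≡uE-vE′ : ε k * (d * Pℤ - m * Qℤ) ≡ u * E - v * E′
    εX≡uE-vE′ = begin
      ε k * (d * Pℤ - m * Qℤ)
        ≡⟨ cong (ε k *_) X≡u[qP-pQ]+v[qP-pQ] ⟨
      ε k * (u * (qℤ A k * Pℤ - pℤ A k * Qℤ) + v * (qℤ A (suc k) * Pℤ - pℤ A (suc k) * Qℤ))
        ≡⟨ cong₂ (λ x y → ε k * (u * x + v * y)) (q*P-p*Q k) (q*P-p*Q (suc k)) ⟩
      ε k * (u * (ε k * E) + v * (- ε k * E′))
        ≡⟨ cong (ε k *_) (lemma u v (ε k) E E′) ⟩
      ε k * (ε k * (u * E - v * E′))
        ≡⟨ ε*[ε*i]≡i k _ ⟩
      u * E - v * E′ ∎
      where
      open ≡-Reasoning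
      lemma : ∀ u v e E E′ → u * (e * E) + v * (- e * E′) ≡ e * (u * E - v * E′)
      lemma = solve-∀

    private
      qq : ℕ
      qq = q A (suc k)

      ¬both-pos : ∀ {u v} → ∣ u * qℤ A k + v * qℤ A (suc k) ∣ ℕ.< qq → 1ℤ ≤ u → 1ℤ ≤ v → ⊥
      ¬both-pos bound 1≤u 1≤v = ℕ.<⇒≱ bound
        (c≤∣i∣ _ (inj₁ (≤-trans (i≤j+i (+ qq) (qℤ A k)) (x+y≤ux+vy (q A k) qq 1≤u 1≤v))))

      ¬both-neg : ∣ d ∣ ℕ.< qq → u ≤ -1ℤ → v ≤ -1ℤ → ⊥
      ¬both-neg bound u≤-1 v≤-1 = ¬both-pos {u = - u} {v = - v}
        (subst (λ z → ∣ z ∣ ℕ.< qq) (trans (cong -_ d≡uq+vq) (lemma u v (qℤ A k) (qℤ A (suc k))))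
          (subst (ℕ._< qq) (sym (∣-i∣≡∣i∣ d)) bound))
        (neg-mono-≤ u≤-1) (neg-mono-≤ v≤-1)
        where
        lemma : ∀ u v q q₁ → - (u * q + v * q₁) ≡ (- u) * q + (- v) * q₁
        lemma = solve-∀

      u≢0 : d ≢ 0ℤ → ∣ d ∣ ℕ.< qq → u ≢ 0ℤ
      u≢0 d≢0 bound u≡0 = d≢0 (∣i∣≡0⇒i≡0 (trans ∣d∣≡∣v∣q (cong (ℕ._* qq) ∣v∣≡0)))
        where
        lemma : ∀ x y → 0ℤ * x + y ≡ y
        lemma = solve-∀
        ∣d∣≡∣v∣q : ∣ d ∣ ≡ ∣ v ∣ ℕ.* qq
        ∣d∣≡∣v∣q = begin
          ∣ d ∣                                   ≡⟨ cong ∣_∣ d≡uq+vq ⟩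
          ∣ u * qℤ A k + v * qℤ A (suc k) ∣      ≡⟨ cong (λ z → ∣ z * qℤ A k + v * qℤ A (suc k) ∣) u≡0 ⟩
          ∣ 0ℤ * qℤ A k + v * qℤ A (suc k) ∣     ≡⟨ cong ∣_∣ (lemma (qℤ A k) (v * qℤ A (suc k))) ⟩
          ∣ v * qℤ A (suc k) ∣                    ≡⟨ abs-* v (qℤ A (suc k)) ⟩
          ∣ v ∣ ℕ.* qq                            ∎
          where open ≡-Reasoning
        ∣v∣≡0 : ∣ v ∣ ≡ 0
        ∣v∣≡0 = m*n<n⇒m≡0 ∣ v ∣ qq (subst (ℕ._< qq) ∣d∣≡∣v∣q bound)

    coefficient-signs : d ≢ 0ℤ → ∣ d ∣ ℕ.< q A (suc k) → (1ℤ ≤ u × v ≤ 0ℤ) ⊎ (u ≤ -1ℤ × 0ℤ ≤ v)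
    coefficient-signs d≢0 bound with sign-cases u | sign-cases v
    ... | inj₂ (inj₁ u≡0)  | _                = ⊥-elim (u≢0 d≢0 bound u≡0)
    ... | inj₁ 1≤u         | inj₁ 1≤v         = ⊥-elim (¬both-pos (subst (λ z → ∣ z ∣ ℕ.< qq) d≡uq+vq bound) 1≤u 1≤v)
    ... | inj₁ 1≤u         | inj₂ (inj₁ v≡0)  = inj₁ (1≤u , ≤-reflexive v≡0)
    ... | inj₁ 1≤u         | inj₂ (inj₂ v≤-1) = inj₁ (1≤u , ≤-trans v≤-1 -≤+)
    ... | inj₂ (inj₂ u≤-1) | inj₁ 1≤v         = inj₂ (u≤-1 , 1≤⇒0≤ 1≤v)
    ... | inj₂ (inj₂ u≤-1) | inj₂ (inj₁ v≡0)  = inj₂ (u≤-1 , ≤-reflexive (sym v≡0))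
    ... | inj₂ (inj₂ u≤-1) | inj₂ (inj₂ v≤-1) = ⊥-elim (¬both-neg bound u≤-1 v≤-1)

    private
      εX-E : ε k * (d * Pℤ - m * Qℤ) - E ≡ (u - 1ℤ) * E + (- v) * E′
      εX-E = trans (cong (_- E) εX≡uE-vE′) (lemma u v E E′)
        where
        lemma : ∀ u v E E′ → u * E - v * E′ - E ≡ (u - 1ℤ) * E + (- v) * E′
        lemma = solve-∀

      -E-εX : - E - ε k * (d * Pℤ - m * Qℤ) ≡ (- u - 1ℤ) * E + v * E′
      -E-εX = trans (cong (λ z → - E - z) εX≡uE-vE′) (lemma u v E E′)
        where
        lemma : ∀ u v E E′ → - E - (u * E - v * E′) ≡ (- u - 1ℤ) * E + v * E′
        lemma = solve-∀

      0≤[u-1]E : 1ℤ ≤ u → 0ℤ ≤ (u - 1ℤ) * E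
      0≤[u-1]E 1≤u = *-nonNeg (i≤j⇒0≤j-i 1≤u) (1≤⇒0≤ 1≤E)

      0≤[-v]E′ : v ≤ 0ℤ → 0ℤ ≤ (- v) * E′
      0≤[-v]E′ v≤0 = *-nonNeg (neg-mono-≤ v≤0) (1≤⇒0≤ 1≤E′)

      εX≤-E : u ≤ -1ℤ → 0ℤ ≤ v → ε k * (d * Pℤ - m * Qℤ) ≤ - E
      εX≤-E u≤-1 0≤v = diff-nonNeg⇒≤ -E-εX
        (+-mono-≤ (*-nonNeg (i≤j⇒0≤j-i (neg-mono-≤ u≤-1)) (1≤⇒0≤ 1≤E)) (*-nonNeg 0≤v (1≤⇒0≤ 1≤E′)))

    εX-bound : d ≢ 0ℤ → ∣ d ∣ ℕ.< q A (suc k) → E ≤ ε k * (d * Pℤ - m * Qℤ) ⊎ ε k * (d * Pℤ - m * Qℤ) ≤ - E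
    εX-bound d≢0 bound with coefficient-signs d≢0 bound
    ... | inj₁ (1≤u , v≤0) = inj₁ (diff-nonNeg⇒≤ εX-E (+-mono-≤ (0≤[u-1]E 1≤u) (0≤[-v]E′ v≤0)))
    ... | inj₂ (u≤-1 , 0≤v) = inj₂ (εX≤-E u≤-1 0≤v)

    εX≡E⇒d≡q : d ≢ 0ℤ → ∣ d ∣ ℕ.< q A (suc k) → ε k * (d * Pℤ - m * Qℤ) ≡ E → d ≡ qℤ A k
    εX≡E⇒d≡q d≢0 bound εX≡E with coefficient-signs d≢0 bound
    ... | inj₂ (u≤-1 , 0≤v) = ⊥-elim (≤-E⇒neg (1≤⇒0≤ 1≤E) (subst (_≤ - E) εX≡E (εX≤-E u≤-1 0≤v)))
    ... | inj₁ (1≤u , v≤0) = begin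
      d                                ≡⟨ d≡uq+vq ⟩
      u * qℤ A k + v * qℤ A (suc k)    ≡⟨ cong₂ (λ x y → x * qℤ A k + y * qℤ A (suc k)) u≡1 v≡0 ⟩
      1ℤ * qℤ A k + 0ℤ * qℤ A (suc k)  ≡⟨ lemma (qℤ A k) (qℤ A (suc k)) ⟩
      qℤ A k                           ∎
      where
      open ≡-Reasoning
      lemma : ∀ x y → 1ℤ * x + 0ℤ * y ≡ x
      lemma = solve-∀
      terms≡0 : (u - 1ℤ) * E ≡ 0ℤ × (- v) * E′ ≡ 0ℤ
      terms≡0 = nonNeg-sum≡0 (0≤[u-1]E 1≤u) (0≤[-v]E′ v≤0) (trans (sym εX-E) (trans (cong (_- E) εX≡E) (+-inverseʳ E)))
      u≡1 : u ≡ 1ℤ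
      u≡1 = i-j≡0⇒i≡j u 1ℤ (i*j≡0⇒i≡0 1≤E (proj₁ terms≡0))
      v≡0 : v ≡ 0ℤ
      v≡0 = trans (sym (neg-involutive v)) (cong -_ (i*j≡0⇒i≡0 1≤E′ (proj₂ terms≡0)))

  open Decomposition using (εX-bound; εX≡E⇒d≡q)

  best-approximation : ∀ d m → d ≢ 0ℤ → ∣ d ∣ ℕ.< q A (suc k) → 0ℤ ≤ d * Pℤ - m * Qℤ → E ≤ d * Pℤ - m * Qℤ
  best-approximation d m d≢0 bound 0≤X with ε-cases k | εX-bound d m d≢0 bound
  ... | inj₁ ε≡1  | inj₁ E≤εX  = subst (E ≤_) (ε≡1⇒ε*i≡i k _ ε≡1) E≤εX
  ... | inj₁ ε≡1  | inj₂ εX≤-E = ⊥-elim (≤-E⇒neg 0≤X (subst (_≤ - E) (ε≡1⇒ε*i≡i k _ ε≡1) εX≤-E))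
  ... | inj₂ ε≡-1 | inj₁ E≤εX  = ⊥-elim (≤-E⇒neg 0≤X
    (subst (_≤ - E) (neg-involutive _) (neg-mono-≤ (subst (E ≤_) (ε≡-1⇒ε*i≡-i k _ ε≡-1) E≤εX))))
  ... | inj₂ ε≡-1 | inj₂ εX≤-E = neg-cancel-≤ (subst (_≤ - E) (ε≡-1⇒ε*i≡-i k _ ε≡-1) εX≤-E)

  best-approximation-eq : ε k ≡ 1ℤ → ∀ d m → d ≢ 0ℤ → ∣ d ∣ ℕ.< q A (suc k) → d * Pℤ - m * Qℤ ≡ E → d ≡ qℤ A k
  best-approximation-eq ε≡1 d m d≢0 bound X≡E = εX≡E⇒d≡q d m d≢0 bound (trans (ε≡1⇒ε*i≡i k _ ε≡1) X≡E)

  private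
    dP-φQ≡ρ : ∀ d → d * Pℤ - φ d * Qℤ ≡ ρ d
    dP-φQ≡ρ d = trans (cong (_- φ d * Qℤ) (φ-ρ d)) (lemma (φ d * Qℤ) (ρ d))
      where
      lemma : ∀ a r → a + r - a ≡ r
      lemma = solve-∀

    -dP-φ′Q≡Q-ρ : ∀ d → (- d) * Pℤ - (- φ d - 1ℤ) * Qℤ ≡ Qℤ - ρ d
    -dP-φ′Q≡Q-ρ d = trans (lemma d Pℤ (φ d) Qℤ) (cong (λ z → Qℤ - z) (dP-φQ≡ρ d))
      where
      lemma : ∀ d P f Q → (- d) * P - (- f - 1ℤ) * Q ≡ Q - (d * P - f * Q)
      lemma = solve-∀

    -≢0 : ∀ {d} → d ≢ 0ℤ → - d ≢ 0ℤ
    -≢0 {d} d≢0 -d≡0 = d≢0 (trans (sym (neg-involutive d)) (cong -_ -d≡0))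

    ∣-∣< : ∀ d → ∣ d ∣ ℕ.< q A (suc k) → ∣ - d ∣ ℕ.< q A (suc k)
    ∣-∣< d = subst (ℕ._< q A (suc k)) (sym (∣-i∣≡∣i∣ d))

    E≤Q-ρ : ∀ d → d ≢ 0ℤ → ∣ d ∣ ℕ.< q A (suc k) → E ≤ Qℤ - ρ d
    E≤Q-ρ d d≢0 bound = subst (E ≤_) (-dP-φ′Q≡Q-ρ d) (best-approximation (- d) (- φ d - 1ℤ) (-≢0 d≢0) (∣-∣< d bound)
      (subst (0ℤ ≤_) (sym (-dP-φ′Q≡Q-ρ d)) (i≤j⇒0≤j-i (<⇒≤ (ρ<Q d)))))

    E≤j-i⇒i+E≤j : ∀ i j → E ≤ j - i → i + E ≤ j
    E≤j-i⇒i+E≤j i j E≤j-i = diff-nonNeg⇒≤ (lemma i j E) (i≤j⇒0≤j-i E≤j-i)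
      where
      lemma : ∀ i j E → j - (i + E) ≡ (j - i) - E
      lemma = solve-∀

  E≤ρ : ∀ d → d ≢ 0ℤ → ∣ d ∣ ℕ.< q A (suc k) → E ≤ ρ d
  E≤ρ d d≢0 bound = subst (E ≤_) (dP-φQ≡ρ d)
    (best-approximation d (φ d) d≢0 bound (subst (0ℤ ≤_) (sym (dP-φQ≡ρ d)) (0≤ρ d)))

  ρ+E≤Q : ∀ d → d ≢ 0ℤ → ∣ d ∣ ℕ.< q A (suc k) → ρ d + E ≤ Qℤ
  ρ+E≤Q d d≢0 bound = E≤j-i⇒i+E≤j (ρ d) Qℤ (E≤Q-ρ d d≢0 bound)

  ρ+E<Q : ε k ≡ 1ℤ → ∀ d → d ≢ 0ℤ → d ≢ - qℤ A k → ∣ d ∣ ℕ.< q A (suc k) → ρ d + E < Qℤ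
  ρ+E<Q ε≡1 d d≢0 d≢-q bound = ≤∧≢⇒< (ρ+E≤Q d d≢0 bound) ρ+E≢Q
    where
    ρ+E≢Q : ρ d + E ≢ Qℤ
    ρ+E≢Q ρ+E≡Q = d≢-q (trans (sym (neg-involutive d)) (cong -_
      (best-approximation-eq ε≡1 (- d) (- φ d - 1ℤ) (-≢0 d≢0) (∣-∣< d bound)
        (trans (-dP-φ′Q≡Q-ρ d) (trans (cong (_- ρ d) (sym ρ+E≡Q)) (lemma (ρ d) E))))))
      where
      lemma : ∀ r E → r + E - r ≡ E
      lemma = solve-∀

  private
    x-y≡c⇒x≡y+c : ∀ {x y c} → x - y ≡ c → x ≡ y + c
    x-y≡c⇒x≡y+c {x} {y} {c} eq = trans (lemma x y) (cong (λ z → y + z) eq)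
      where
      lemma : ∀ x y → x ≡ y + (x - y)
      lemma = solve-∀

  ρ-q-pos : ∀ j → ε j ≡ 1ℤ → 0ℤ ≤ cross A j L → cross A j L < Qℤ → ρ (qℤ A j) ≡ cross A j L
  ρ-q-pos j ε≡1 0≤c c<Q =
    ρ-unique (qℤ A j) (pℤ A j) (x-y≡c⇒x≡y+c (trans (q*P-p*Q j) (ε≡1⇒ε*i≡i j _ ε≡1))) 0≤c c<Q
  ρ-q-neg : ∀ j → ε j ≡ -1ℤ → 1ℤ ≤ cross A j L → cross A j L < Qℤ → ρ (qℤ A j) ≡ Qℤ - cross A j L
  ρ-q-neg j ε≡-1 1≤c c<Q =
    ρ-unique (qℤ A j) (pℤ A j - 1ℤ) eq (i≤j⇒0≤j-i (<⇒≤ c<Q)) (diff-pos⇒< (lemma Qℤ c) 1≤c)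
    where
    c : ℤ
    c = cross A j L
    lemma : ∀ Q c → Q - (Q - c) ≡ c
    lemma = solve-∀
    lemma′ : ∀ p Q c → p * Q + - c ≡ (p - 1ℤ) * Q + (Q - c)
    lemma′ = solve-∀
    eq : qℤ A j * Pℤ ≡ (pℤ A j - 1ℤ) * Qℤ + (Qℤ - c)
    eq = trans (x-y≡c⇒x≡y+c (trans (q*P-p*Q j) (ε≡-1⇒ε*i≡-i j c ε≡-1))) (lemma′ (pℤ A j) Qℤ c)

  E′<Q : E′ < Qℤ
  E′<Q = <-trans E′<E E<Q

  ρ-q≡E : ε k ≡ 1ℤ → ρ (qℤ A k) ≡ E
  ρ-q≡E ε≡1 = ρ-q-pos k ε≡1 (1≤⇒0≤ 1≤E) E<Q

  ρ-q≡Q-E : ε k ≡ -1ℤ → ρ (qℤ A k) ≡ Qℤ - E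
  ρ-q≡Q-E ε≡-1 = ρ-q-neg k ε≡-1 1≤E E<Q

  ρ-q-suc≡E′ : ε k ≡ -1ℤ → ρ (qℤ A (suc k)) ≡ E′
  ρ-q-suc≡E′ ε≡-1 = ρ-q-pos (suc k) (cong -_ ε≡-1) (1≤⇒0≤ 1≤E′) E′<Q

  ρ-q-suc≡Q-E′ : ε k ≡ 1ℤ → ρ (qℤ A (suc k)) ≡ Qℤ - E′
  ρ-q-suc≡Q-E′ ε≡1 = ρ-q-neg (suc k) (cong -_ ε≡1) 1≤E′ E′<Q

  ρ-q+q-suc≡E-E′ : ε k ≡ 1ℤ → ρ (+ (q A k ℕ.+ q A (suc k))) ≡ E - E′
  ρ-q+q-suc≡E-E′ ε≡1 = begin
    ρ (+ (q A k ℕ.+ q A (suc k)))                 ≡⟨ cong ρ (pos-+ (q A k) (q A (suc k))) ⟩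
    ρ (qℤ A k + qℤ A (suc k))                     ≡⟨ ρ-+-carry (qℤ A k) (qℤ A (suc k)) carry ⟩
    ρ (qℤ A k) + ρ (qℤ A (suc k)) - Qℤ            ≡⟨ cong₂ (λ x y → x + y - Qℤ) (ρ-q≡E ε≡1) (ρ-q-suc≡Q-E′ ε≡1) ⟩
    E + (Qℤ - E′) - Qℤ                            ≡⟨ lemma E Qℤ E′ ⟩
    E - E′                                        ∎
    where
    open ≡-Reasoning
    lemma : ∀ E Q E′ → E + (Q - E′) - Q ≡ E - E′
    lemma = solve-∀
    carry : Qℤ ≤ ρ (qℤ A k) + ρ (qℤ A (suc k))
    carry = subst₂ (λ x y → Qℤ ≤ x + y) (sym (ρ-q≡E ε≡1)) (sym (ρ-q-suc≡Q-E′ ε≡1))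
      (diff-nonNeg⇒≤ (lemma E Qℤ E′) (i≤j⇒0≤j-i (<⇒≤ E′<E)))

argmin : (f : ℕ → ℕ) (n : ℕ) → Σ[ a ∈ ℕ ] a ℕ.≤ n × (∀ s → s ℕ.≤ n → f a ℕ.≤ f s)
argmin f zero = 0 , ℕ.z≤n , λ { zero _ → ℕ.≤-refl }
argmin f (suc n) with argmin f n
... | a , a≤n , min with f a ℕ.≤? f (suc n)
...   | yes fa≤ = a , ℕ.m≤n⇒m≤1+n a≤n , min′
  where
  min′ : ∀ s → s ℕ.≤ suc n → f a ℕ.≤ f s
  min′ s s≤ with ℕ.m≤n⇒m<n∨m≡n s≤
  ... | inj₁ (ℕ.s≤s s≤n) = min s s≤n
  ... | inj₂ refl        = fa≤
...   | no fa≰ = suc n , ℕ.≤-refl , min′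
  where
  min′ : ∀ s → s ℕ.≤ suc n → f (suc n) ℕ.≤ f s
  min′ s s≤ with ℕ.m≤n⇒m<n∨m≡n s≤
  ... | inj₁ (ℕ.s≤s s≤n) = ℕ.≤-trans (ℕ.<⇒≤ (ℕ.≰⇒> fa≰)) (min s s≤n)
  ... | inj₂ refl        = ℕ.≤-refl

∣s-a∣≤n : ∀ {s a n} → s ℕ.≤ n → a ℕ.≤ n → ∣ + s - + a ∣ ℕ.≤ n
∣s-a∣≤n {s} {a} s≤n a≤n =
  subst (ℕ._≤ _) (cong ∣_∣ (sym (m-n≡m⊖n s a))) (ℕ.≤-trans (∣m⊝n∣≤m⊔n s a) (ℕ.⊔-lub s≤n a≤n))

module Windows (A : ℕ → ℕ) (A≥1 : ∀ i → 1 ℕ.≤ A i) (K k : ℕ) (k<K : k ℕ.< K)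
               (n : ℕ) (n<q : n ℕ.< q A (suc k)) where

  open BestApproximation A A≥1 K k k<K public

  D : ℤ → ℕ → ℤ
  D x s = φ (x + + s) - φ x

  ρ-0 : ρ 0ℤ ≡ 0ℤ
  ρ-0 = ρ-unique 0ℤ 0ℤ (lemma Pℤ Qℤ) ≤-refl (≤-<-trans (0≤+ _) P<Q)
    where
    lemma : ∀ P Q → 0ℤ * P ≡ 0ℤ * Q + 0ℤ
    lemma = solve-∀

  window-noCarry : ∀ x a → (∀ s → s ℕ.≤ n → ρ x + ρ (+ s - + a) < Qℤ) →
                   ∀ s → s ℕ.≤ n → D (x - + a) s ≡ φ (+ s - + a) - φ (+ 0 - + a)
  window-noCarry x a noCarry s s≤n = begin
    φ (x - + a + + s) - φ (x - + a)
      ≡⟨ cong₂ _-_ (shift s s≤n) (trans (cong φ (sym (+-identityʳ (x - + a)))) (shift 0 ℕ.z≤n)) ⟩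
    (φ x + φ (+ s - + a)) - (φ x + φ (+ 0 - + a))     ≡⟨ lemma (φ x) (φ (+ s - + a)) (φ (+ 0 - + a)) ⟩
    φ (+ s - + a) - φ (+ 0 - + a)                     ∎
    where
    open ≡-Reasoning
    lemma : ∀ f g h → (f + g) - (f + h) ≡ g - h
    lemma = solve-∀
    regroup : ∀ x a s → x - a + s ≡ x + (s - a)
    regroup = solve-∀
    shift : ∀ s → s ℕ.≤ n → φ (x - + a + + s) ≡ φ x + φ (+ s - + a)
    shift s s≤n = trans (cong φ (regroup x (+ a) (+ s))) (φ-+-noCarry x _ (noCarry s s≤n))

  -- Started at its point of least residue, a window has no carry.
  window-by-min-residue : ∀ i → Σ[ a ∈ ℕ ] a ℕ.≤ n × (∀ s → s ℕ.≤ n → D i s ≡ φ (+ s - + a) - φ (+ 0 - + a))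
  window-by-min-residue i with argmin (λ s → ∣ ρ (i + + s) ∣) n
  ... | a , a≤n , minimal = a , a≤n , λ s s≤n → trans (cong (λ x → D x s) i≡y-a) (window-noCarry y a noCarry s s≤n)
    where
    y : ℤ
    y = i + + a
    i≡y-a : i ≡ y - + a
    i≡y-a = lemma i (+ a)
      where
      lemma : ∀ i a → i ≡ i + a - a
      lemma = solve-∀
    ρy≤ρ[i+s] : ∀ s → s ℕ.≤ n → ρ y ≤ ρ (i + + s)
    ρy≤ρ[i+s] s s≤n = subst₂ _≤_ (0≤i⇒+∣i∣≡i (0≤ρ y)) (0≤i⇒+∣i∣≡i (0≤ρ (i + + s))) (+≤+ (minimal s s≤n))
    noCarry : ∀ s → s ℕ.≤ n → ρ y + ρ (+ s - + a) < Qℤ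
    noCarry s s≤n with ρ y + ρ (+ s - + a) <? Qℤ
    ... | yes noCarry = noCarry
    ... | no carry = ⊥-elim (<⇒≱ ρ[i+s]<ρy (ρy≤ρ[i+s] s s≤n))
      where
      regroup : ∀ i a s → i + a + (s - a) ≡ i + s
      regroup = solve-∀
      lemma : ∀ r t Q → r - (r + t - Q) ≡ Q - t
      lemma = solve-∀
      ρ[i+s]<ρy : ρ (i + + s) < ρ y
      ρ[i+s]<ρy = subst (_< ρ y) (trans (sym (ρ-+-carry y (+ s - + a) (≮⇒≥ carry))) (cong ρ (regroup i (+ a) (+ s))))
        (diff-pos⇒< (lemma (ρ y) (ρ (+ s - + a)) Qℤ) (<⇒1≤diff (ρ<Q (+ s - + a))))

  SmallResidue : ℕ → ℕ → Set
  SmallResidue m a = ρ (+ m) < E ⊎ (ρ (+ m) ≡ E × ε k ≡ 1ℤ × a ℕ.< q A k)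

  small-residue⇒noCarry : ∀ m a → a ℕ.≤ n → SmallResidue m a → ∀ s → s ℕ.≤ n → ρ (+ m) + ρ (+ s - + a) < Qℤ
  small-residue⇒noCarry m a a≤n small s s≤n with + s - + a ≟ 0ℤ
  ... | yes d≡0 = subst (λ r → ρ (+ m) + r < Qℤ) (sym (trans (cong ρ d≡0) ρ-0))
                    (subst (_< Qℤ) (sym (+-identityʳ _)) (ρ<Q (+ m)))
  ... | no d≢0 = noCarry small
    where
    d : ℤ
    d = + s - + a
    bound : ∣ d ∣ ℕ.< q A (suc k)
    bound = ℕ.≤-<-trans (∣s-a∣≤n s≤n a≤n) n<q
    noCarry : SmallResidue m a → ρ (+ m) + ρ d < Qℤ
    noCarry (inj₁ ρ<E) = <-≤-trans (+-monoˡ-< (ρ d) ρ<E)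
                            (subst (_≤ Qℤ) (+-comm (ρ d) E) (ρ+E≤Q d d≢0 bound))
    noCarry (inj₂ (ρ≡E , ε≡1 , a<q)) = subst (λ r → r + ρ d < Qℤ) (sym ρ≡E)
      (subst (_< Qℤ) (+-comm (ρ d) E) (ρ+E<Q ε≡1 d d≢0 d≢-q bound))
      where
      d≢-q : d ≢ - qℤ A k
      d≢-q d≡-q = ℕ.<⇒≱ a<q (drop‿+≤+ (diff-nonNeg⇒≤ (lemma (+ s) (+ a) (qℤ A k) d≡-q) (0≤+ s)))
        where
        lemma : ∀ s a q → s - a ≡ - q → a - q ≡ s
        lemma s a q eq = trans (cong (λ z → a + z) (sym eq)) (cancel a s)
          where
          cancel : ∀ a s → a + (s - a) ≡ s
          cancel = solve-∀

  small-residue-shift : ∀ a → a ℕ.≤ n → Σ[ m ∈ ℕ ] a ℕ.< m × m ℕ.≤ a ℕ.+ q A (suc k) × SmallResidue m a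
  small-residue-shift a a≤n with ε-cases k
  ... | inj₂ ε≡-1 = q A (suc k) , ℕ.≤-<-trans a≤n n<q , ℕ.m≤n+m _ a ,
    inj₁ (subst (_< E) (sym (ρ-q-suc≡E′ ε≡-1)) E′<E)
  ... | inj₁ ε≡1 with a ℕ.<? q A k
  ...   | yes a<q = q A k , a<q , ℕ.≤-trans (q≤q-suc A A≥1 k) (ℕ.m≤n+m _ a) , inj₂ (ρ-q≡E ε≡1 , ε≡1 , a<q)
  ...   | no a≮q = q A k ℕ.+ q A (suc k) ,
    ℕ.<-≤-trans (ℕ.≤-<-trans a≤n n<q) (ℕ.m≤n+m _ (q A k)) ,
    ℕ.+-monoˡ-≤ (q A (suc k)) (ℕ.≮⇒≥ a≮q) ,
    inj₁ (subst (_< E) (sym (ρ-q+q-suc≡E-E′ ε≡1)) (diff-pos⇒< (lemma E E′) 1≤E′))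
    where
    lemma : ∀ E E′ → E - (E - E′) ≡ E′
    lemma = solve-∀

  exhaustion : ∀ i → Σ[ i′ ∈ ℕ ] 1 ℕ.≤ i′ × i′ ℕ.≤ q A (suc k) × (∀ s → s ℕ.≤ n → D i s ≡ D (+ i′) s)
  exhaustion i with window-by-min-residue i
  ... | a , a≤n , Di≡ with small-residue-shift a a≤n
  ...   | m , a<m , m≤a+q , small = m ℕ.∸ a , ℕ.m<n⇒0<n∸m a<m , ℕ.m≤n+o⇒m∸n≤o m a m≤a+q ,
    λ s s≤n → trans (Di≡ s s≤n) (sym (trans (cong (λ x → D x s) +[m∸a]≡m-a)
      (window-noCarry (+ m) a (small-residue⇒noCarry m a a≤n small) s s≤n)))
    where
    +[m∸a]≡m-a : + (m ℕ.∸ a) ≡ + m - + a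
    +[m∸a]≡m-a = sym (trans (m-n≡m⊖n m a) (⊖-≥ (ℕ.<⇒≤ a<m)))

  D-noCarry : ∀ x s → ρ x + ρ (+ s) < Qℤ → D x s ≡ φ (+ s)
  D-noCarry x s noCarry = trans (cong (_- φ x) (φ-+-noCarry x (+ s) noCarry)) (lemma (φ x) (φ (+ s)))
    where
    lemma : ∀ a b → a + b - a ≡ b
    lemma = solve-∀

  D-carry : ∀ x s → Qℤ ≤ ρ x + ρ (+ s) → D x s ≡ sucℤ (φ (+ s))
  D-carry x s carry = trans (cong (_- φ x) (φ-+-carry x (+ s) carry)) (lemma (φ x) (φ (+ s)))
    where
    lemma : ∀ a b → (1ℤ + (a + b)) - a ≡ 1ℤ + b
    lemma = solve-∀

  private
    +i′≢0 : ∀ {i′} → 1 ℕ.≤ i′ → + i′ ≢ 0ℤ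
    +i′≢0 1≤i′ refl = ℕ.<⇒≢ 1≤i′ refl

    +i′≢-q : ∀ {i′} → 1 ℕ.≤ i′ → + i′ ≢ - qℤ A k
    +i′≢-q {i′} _ i′≡-q =
      0≰-1 (≤-trans (0≤+ i′) (subst (_≤ -1ℤ) (sym i′≡-q) (neg-mono-≤ (+≤+ (1≤q A A≥1 k)))))

  window-separation : ∀ i′ → 1 ℕ.≤ i′ → i′ ℕ.< q A (suc k) → D (+ i′) (q A k) ≢ D (qℤ A (suc k)) (q A k)
  window-separation i′ 1≤i′ i′<q with ε-cases k
  ... | inj₂ ε≡-1 = λ eq → i≢suc[i] (trans (sym (D-noCarry _ _ noCarry-q)) (trans (sym eq) (D-carry _ _ carry-i′)))
    where
    noCarry-q : ρ (qℤ A (suc k)) + ρ (qℤ A k) < Qℤ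
    noCarry-q = subst₂ (λ x y → x + y < Qℤ) (sym (ρ-q-suc≡E′ ε≡-1)) (sym (ρ-q≡Q-E ε≡-1))
      (diff-pos⇒< (lemma Qℤ E E′) (<⇒1≤diff E′<E))
      where
      lemma : ∀ Q E E′ → Q - (E′ + (Q - E)) ≡ E - E′
      lemma = solve-∀
    carry-i′ : Qℤ ≤ ρ (+ i′) + ρ (qℤ A k)
    carry-i′ = subst (λ y → Qℤ ≤ ρ (+ i′) + y) (sym (ρ-q≡Q-E ε≡-1))
      (diff-nonNeg⇒≤ (lemma Qℤ E (ρ (+ i′))) (i≤j⇒0≤j-i (E≤ρ (+ i′) (+i′≢0 1≤i′) i′<q)))
      where
      lemma : ∀ Q E r → r + (Q - E) - Q ≡ r - E
      lemma = solve-∀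
  ... | inj₁ ε≡1 = λ eq → i≢suc[i] (trans (sym (D-noCarry _ _ noCarry-i′)) (trans eq (D-carry _ _ carry-q)))
    where
    noCarry-i′ : ρ (+ i′) + ρ (qℤ A k) < Qℤ
    noCarry-i′ = subst (λ y → ρ (+ i′) + y < Qℤ) (sym (ρ-q≡E ε≡1))
      (ρ+E<Q ε≡1 (+ i′) (+i′≢0 1≤i′) (+i′≢-q 1≤i′) i′<q)
    carry-q : Qℤ ≤ ρ (qℤ A (suc k)) + ρ (qℤ A k)
    carry-q = subst₂ (λ x y → Qℤ ≤ x + y) (sym (ρ-q-suc≡Q-E′ ε≡1)) (sym (ρ-q≡E ε≡1))
      (diff-nonNeg⇒≤ (lemma Qℤ E E′) (i≤j⇒0≤j-i (<⇒≤ E′<E)))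
      where
      lemma : ∀ Q E E′ → Q - E′ + E - Q ≡ E - E′
      lemma = solve-∀

module Words (A : ℕ → ℕ) (A≥1 : ∀ i → 1 ℕ.≤ A i) (K k : ℕ) (k<K : k ℕ.< K)
             (n : ℕ) (n<q : n ℕ.< q A (suc k)) where

  open Windows A A≥1 K k k<K n n<q public

  InRange : ℤ → Set
  InRange x = ∣ x ∣ ℕ.+ n ℕ.< Q

  private
    bounds : ∀ x t → InRange x → t ℕ.< n → ∣ x + + t ∣ ℕ.< Q × ∣ x + + t + 1ℤ ∣ ℕ.< Q
    bounds x t inRange t<n = ℕ.≤-<-trans ∣x+t∣≤ inRange , ℕ.≤-<-trans ∣x+t+1∣≤ inRange
      where
      ∣x+t∣≤ : ∣ x + + t ∣ ℕ.≤ ∣ x ∣ ℕ.+ n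
      ∣x+t∣≤ = ℕ.≤-trans (∣i+j∣≤∣i∣+∣j∣ x (+ t)) (ℕ.+-monoʳ-≤ ∣ x ∣ (ℕ.<⇒≤ t<n))
      ∣x+t+1∣≤ : ∣ x + + t + 1ℤ ∣ ℕ.≤ ∣ x ∣ ℕ.+ n
      ∣x+t+1∣≤ = ℕ.≤-trans (∣i+j∣≤∣i∣+∣j∣ (x + + t) 1ℤ)
        (ℕ.≤-trans (ℕ.+-monoˡ-≤ 1 (∣i+j∣≤∣i∣+∣j∣ x (+ t)))
          (subst (ℕ._≤ ∣ x ∣ ℕ.+ n) (sym (trans (ℕ.+-assoc ∣ x ∣ t 1) (cong (∣ x ∣ ℕ.+_) (ℕ.+-comm t 1))))
            (ℕ.+-monoʳ-≤ ∣ x ∣ t<n)))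

  Δφ≡D-D : ∀ x t → Δφ (x + + t) ≡ D x (suc t) - D x t
  Δφ≡D-D x t = begin
    φ (x + + t + 1ℤ) - φ (x + + t)                         ≡⟨ cong (λ z → φ z - φ (x + + t)) x+t+1≡x+[1+t] ⟩
    φ (x + + suc t) - φ (x + + t)                          ≡⟨ lemma′ (φ (x + + suc t)) (φ (x + + t)) (φ x) ⟩
    (φ (x + + suc t) - φ x) - (φ (x + + t) - φ x)          ∎
    where
    open ≡-Reasoning
    x+t+1≡x+[1+t] : x + + t + 1ℤ ≡ x + + suc t
    x+t+1≡x+[1+t] = trans (+-assoc x (+ t) 1ℤ) (cong (λ z → x + z) (cong +_ (ℕ.+-comm t 1)))
    lemma′ : ∀ a b c → a - b ≡ (a - c) - (b - c)
    lemma′ = solve-∀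

  D-zero : ∀ x → D x 0 ≡ 0ℤ
  D-zero x = trans (cong (λ z → φ z - φ x) (+-identityʳ x)) (+-inverseʳ (φ x))

  SameWindow : ℤ → ℤ → Set
  SameWindow x x′ = ∀ s → s ℕ.≤ n → D x s ≡ D x′ s

  sameWindow⇒Δφ≡ : ∀ {x x′} → SameWindow x x′ → ∀ t → t ℕ.< n → Δφ (x + + t) ≡ Δφ (x′ + + t)
  sameWindow⇒Δφ≡ {x} {x′} same t t<n = begin
    Δφ (x + + t)               ≡⟨ Δφ≡D-D x t ⟩
    D x (suc t) - D x t        ≡⟨ cong₂ _-_ (same (suc t) t<n) (same t (ℕ.<⇒≤ t<n)) ⟩
    D x′ (suc t) - D x′ t      ≡⟨ Δφ≡D-D x′ t ⟨
    Δφ (x′ + + t)              ∎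
    where open ≡-Reasoning

  Δφ≡⇒sameWindow : ∀ {x x′} → (∀ t → t ℕ.< n → Δφ (x + + t) ≡ Δφ (x′ + + t)) → SameWindow x x′
  Δφ≡⇒sameWindow {x} {x′} Δφ≡ zero    _   = trans (D-zero x) (sym (D-zero x′))
  Δφ≡⇒sameWindow {x} {x′} Δφ≡ (suc s) s<n = begin
    D x (suc s)                      ≡⟨ lemma (D x (suc s)) (D x s) ⟩
    D x s + (D x (suc s) - D x s)
      ≡⟨ cong₂ _+_ (Δφ≡⇒sameWindow Δφ≡ s (ℕ.<⇒≤ s<n)) (trans (sym (Δφ≡D-D x s)) (trans (Δφ≡ s s<n) (Δφ≡D-D x′ s))) ⟩
    D x′ s + (D x′ (suc s) - D x′ s) ≡⟨ lemma (D x′ (suc s)) (D x′ s) ⟨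
    D x′ (suc s)                     ∎
    where
    open ≡-Reasoning
    lemma : ∀ a b → a ≡ b + (a - b)
    lemma = solve-∀

  occurs⇒Δφ : ∀ x (w : Vec Bool n) → InRange x → OccursAt A w x → ∀ t → Δφ (x + + toℕ t) ≡ ⟦ lookup w t ⟧
  occurs⇒Δφ x w inRange occ t = V⇒Δφ P<Q (x + + toℕ t) (lookup w t) (bounds x (toℕ t) inRange (toℕ<n t)) (occ t)

  Δφ⇒occurs : ∀ x (w : Vec Bool n) → InRange x → (∀ t → Δφ (x + + toℕ t) ≡ ⟦ lookup w t ⟧) → OccursAt A w x
  Δφ⇒occurs x w inRange Δφ≡ t = Δφ⇒V (x + + toℕ t) (lookup w t) (bounds x (toℕ t) inRange (toℕ<n t)) (Δφ≡ t)

  occurs-transfer : ∀ x x′ {w : Vec Bool n} →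
    InRange x → InRange x′ → SameWindow x x′ → OccursAt A w x → OccursAt A w x′
  occurs-transfer x x′ {w} inRange inRange′ same occ = Δφ⇒occurs x′ w inRange′ λ t →
    trans (sym (sameWindow⇒Δφ≡ same (toℕ t) (toℕ<n t))) (occurs⇒Δφ x w inRange occ t)

  occurs⇒sameWindow : ∀ x x′ {w : Vec Bool n} →
    InRange x → InRange x′ → OccursAt A w x → OccursAt A w x′ → SameWindow x x′
  occurs⇒sameWindow x x′ {w} inRange inRange′ occ occ′ = Δφ≡⇒sameWindow λ t t<n →
    subst (λ u → Δφ (x + + u) ≡ Δφ (x′ + + u)) (toℕ-fromℕ< t<n)
      (trans (occurs⇒Δφ x w inRange occ (fromℕ< t<n)) (sym (occurs⇒Δφ x′ w inRange′ occ′ (fromℕ< t<n))))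

  wordAt : ℤ → Vec Bool n
  wordAt x = tabulate λ t → does (Δφ (x + + toℕ t) ≟ 1ℤ)

  occurs-wordAt : ∀ x → InRange x → OccursAt A (wordAt x) x
  occurs-wordAt x inRange = Δφ⇒occurs x (wordAt x) inRange λ t → trans (bit t) (cong ⟦_⟧ (sym (lookup∘tabulate _ t)))
    where
    bit : ∀ t → Δφ (x + + toℕ t) ≡ ⟦ does (Δφ (x + + toℕ t) ≟ 1ℤ) ⟧
    bit t with Δφ (x + + toℕ t) ≟ 1ℤ
    ... | yes Δ≡1 = Δ≡1
    ... | no Δ≢1 with Δφ∈01 P<Q (x + + toℕ t)
    ...   | inj₁ Δ≡0 = Δ≡0
    ...   | inj₂ Δ≡1 = ⊥-elim (Δ≢1 Δ≡1)

module _ (A : ℕ → ℕ) (A≥1 : ∀ i → 1 ℕ.≤ A i) where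

  large-level : ∀ k B → Σ[ K ∈ ℕ ] k ℕ.< K × B ℕ.< q A (suc (suc K))
  large-level k B = suc (k ℕ.+ B) , ℕ.s≤s (ℕ.m≤m+n k B) ,
    ℕ.≤-trans (ℕ.s≤s (ℕ.m≤n+m B k)) (ℕ.≤-trans (k≤q-suc A A≥1 (suc (k ℕ.+ B))) (q≤q-suc A A≥1 _))

  exhausts : ∀ k n → n ℕ.< q A (suc k) → ∀ N → q A (suc k) ℕ.+ n ℕ.≤ N ℕ.+ 1 → Exhausts A n N
  exhausts k n n<q N bound w (i , occ) with large-level k (∣ i ∣ ℕ.+ q A (suc k) ℕ.+ n)
  ... | K , k<K , big = shifted (exhaustion i)
    where
    open Words A A≥1 K k k<K n n<q
    inRange-i : InRange i
    inRange-i = ℕ.≤-<-trans (ℕ.+-monoˡ-≤ n (ℕ.m≤m+n ∣ i ∣ (q A (suc k)))) big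
    shifted : Σ[ i′ ∈ ℕ ] 1 ℕ.≤ i′ × i′ ℕ.≤ q A (suc k) × SameWindow i (+ i′) → OccursInPrefix A w N
    shifted (i′ , 1≤i′ , i′≤q , same) =
      i′ , 1≤i′ , ℕ.≤-trans (ℕ.+-monoˡ-≤ n i′≤q) bound , occurs-transfer i (+ i′) {w} inRange-i inRange-i′ same occ
      where
      inRange-i′ : InRange (+ i′)
      inRange-i′ = ℕ.≤-<-trans (ℕ.+-monoˡ-≤ n (ℕ.≤-trans i′≤q (ℕ.m≤n+m _ ∣ i ∣))) big

  exhausts⇒ : ∀ k n → q A k ℕ.≤ n → n ℕ.< q A (suc k) → ∀ M → Exhausts A n M → q A (suc k) ℕ.+ n ℕ.≤ M ℕ.+ 1
  exhausts⇒ k n q≤n n<q M ex with large-level k (q A (suc k) ℕ.+ n)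
  ... | K , k<K , big = late (ex w (qℤ A (suc k) , occ))
    where
    open Words A A≥1 K k k<K n n<q
    w : Vec Bool n
    w = wordAt (qℤ A (suc k))
    occ : OccursAt A w (qℤ A (suc k))
    occ = occurs-wordAt (qℤ A (suc k)) big
    late : OccursInPrefix A w M → q A (suc k) ℕ.+ n ℕ.≤ M ℕ.+ 1
    late (i′ , 1≤i′ , i′+n≤M+1 , occ′) = ℕ.≤-trans (ℕ.+-monoˡ-≤ n (ℕ.≮⇒≥ ¬i′<q)) i′+n≤M+1
      where
      ¬i′<q : ¬ i′ ℕ.< q A (suc k)
      ¬i′<q i′<q = window-separation i′ 1≤i′ i′<q
        (occurs⇒sameWindow (+ i′) (qℤ A (suc k)) {w} (ℕ.≤-<-trans (ℕ.+-monoˡ-≤ n (ℕ.<⇒≤ i′<q)) big) big occ′ occ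
          (q A k) q≤n)

m+[n+j]≡m+n∸1+j+1 : ∀ m n j → 1 ℕ.≤ m ℕ.+ n → m ℕ.+ (n ℕ.+ j) ≡ m ℕ.+ n ℕ.∸ 1 ℕ.+ j ℕ.+ 1
m+[n+j]≡m+n∸1+j+1 m n j 1≤m+n = begin
  m ℕ.+ (n ℕ.+ j)              ≡⟨ ℕ.+-assoc m n j ⟨
  m ℕ.+ n ℕ.+ j                ≡⟨ cong (ℕ._+ j) (ℕ.m∸n+n≡m 1≤m+n) ⟨
  m ℕ.+ n ℕ.∸ 1 ℕ.+ 1 ℕ.+ j    ≡⟨ ℕ.+-assoc (m ℕ.+ n ℕ.∸ 1) 1 j ⟩
  m ℕ.+ n ℕ.∸ 1 ℕ.+ (1 ℕ.+ j)  ≡⟨ cong (m ℕ.+ n ℕ.∸ 1 ℕ.+_) (ℕ.+-comm 1 j) ⟩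
  m ℕ.+ n ℕ.∸ 1 ℕ.+ (j ℕ.+ 1)  ≡⟨ ℕ.+-assoc (m ℕ.+ n ℕ.∸ 1) j 1 ⟨
  m ℕ.+ n ℕ.∸ 1 ℕ.+ j ℕ.+ 1    ∎
  where open ≡-Reasoning

theorem3p1 : (A : ℕ → ℕ) → (∀ i → 1 ℕ.≤ A i) →
    (k j : ℕ) → 2 ℕ.≤ q A k ℕ.+ j → q A k ℕ.+ j ℕ.< q A (suc k) →
    IsF A (q A k ℕ.+ j) (q A (suc k) ℕ.+ q A k ℕ.∸ 1 ℕ.+ j)
theorem3p1 A A≥1 k j _ n<q =
  exhausts A A≥1 k n n<q N (ℕ.≤-reflexive N+1≡) ,
  λ M ex → ℕ.+-cancelʳ-≤ 1 N M (subst (ℕ._≤ M ℕ.+ 1) N+1≡ (exhausts⇒ A A≥1 k n (ℕ.m≤m+n (q A k) j) n<q M ex))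
  where
  n N : ℕ
  n = q A k ℕ.+ j
  N = q A (suc k) ℕ.+ q A k ℕ.∸ 1 ℕ.+ j
  N+1≡ : q A (suc k) ℕ.+ n ≡ N ℕ.+ 1
  N+1≡ = m+[n+j]≡m+n∸1+j+1 (q A (suc k)) (q A k) j (ℕ.≤-trans (1≤q A A≥1 k) (ℕ.m≤n+m (q A k) (q A (suc k))))
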